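{- Let $\mathcal{M}$ be a relational structure with domain $M$ and $\mathcal{L}$ a logic such that the $\mathcal{L}$-theory of $\mathcal{M}$ is decidable. Then the class of $\mathcal{M}$-$\mathcal{L}$-Büchi recognizable $\omega$-languages is effectively closed under union, projection (from $M^n$ to $M^{n-1}$) and complementation (with respect to $(M^n)^\omega$).
   Context: An $\mathcal{M}$-$\mathcal{L}$-Büchi automaton over $M^n$ is $\mathcal{B}=(Q,M^n,q_0,\Delta,F)$ with finite state set $Q$, initial state $q_0$, accepting set $F\subseteq Q$, and finite transition relation $\Delta\subseteq Q\times\Phi_n\times Q$, where $\Phi_n$ is the set of $\mathcal{L}$-formulas (over the signature of $\mathcal{M}$) with $n$ free variables. A run on an $\omega$-word over $M^n$ with letters $(a_1(i),\dots,a_n(i))$ is a state sequence $\rho$ with $\rho(0)=q_0$ such that for each $i$ there is $(\rho(i),\phi,\rho(i+1))\in\Delta$ with $\mathcal{M}\models\phi[a_1(i),\dots,a_n(i)]$; the word is accepted if some run visits $F$ infinitely often. An $\omega$-language is $\mathcal{M}$-$\mathcal{L}$-Büchi recognizable if it is the set of words accepted by such an automaton. "Effectively closed" means that automata for the resulting languages can be computed from the given automata. -}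

module Defs where

open import Level using (0ℓ)
open import Data.Nat using (ℕ; zero; suc; _≤_)
open import Data.Fin using (Fin)
open import Data.Fin.Subset using (Subset; _∈_)
open import Data.List using (List)
open import Data.List.Membership.Propositional renaming (_∈_ to _∈ₗ_)
open import Data.Product using (Σ; Σ-syntax; ∃-syntax; _×_; _,_)
open import Data.Sum using (_⊎_)
open import Data.Unit using (⊤)
open import Data.Vec.Functional using (Vector; init)
open import Relation.Nullary using (¬_; Dec)
open import Relation.Binary.PropositionalEquality using (_≡_)
open import Function.Bundles using (_⇔_)
open import Axiom.ExcludedMiddle using (ExcludedMiddle)

-- An abstract logic ℒ interpreted in a fixed (relational) structure 𝓜 with
-- domain M.  `Formula n` is Φₙ, the set of ℒ-formulas (over the signature
-- of 𝓜) with free variables x₀ … x_{n-1}; `Sat v φ` means 𝓜 ⊨ φ[v].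
-- As for the usual logics (FO, MSO, …) we require ⊤, ∧, ¬ and
-- existential quantification of the last free variable.
record Logic (M : Set) : Set₁ where
  field
    Formula : ℕ → Set
    Sat     : ∀ {n} → Vector M n → Formula n → Set
    Sat-ext : ∀ {n} {u v : Vector M n} {φ : Formula n} →
              (∀ k → u k ≡ v k) → Sat u φ → Sat v φ
    true    : ∀ {n} → Formula n
    _and_   : ∀ {n} → Formula n → Formula n → Formula n
    not     : ∀ {n} → Formula n → Formula n
    exists  : ∀ {n} → Formula (suc n) → Formula n
    Sat-true   : ∀ {n} (v : Vector M n) → Sat v true ⇔ ⊤
    Sat-and    : ∀ {n} (v : Vector M n) (φ ψ : Formula n) →
                 Sat v (φ and ψ) ⇔ (Sat v φ × Sat v ψ)
    Sat-not    : ∀ {n} (v : Vector M n) (φ : Formula n) →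
                 Sat v (not φ) ⇔ (¬ Sat v φ)
    Sat-exists : ∀ {n} (v : Vector M n) (φ : Formula (suc n)) →
                 Sat v (exists φ) ⇔
                 (Σ[ u ∈ Vector M (suc n) ] ((∀ k → init u k ≡ v k) × Sat u φ))

module _ {M : Set} (L : Logic M) where
  open Logic L

  TheoryDecidable : Set
  TheoryDecidable = (φ : Formula 0) → Dec (Sat (λ ()) φ)

  -- 𝓜-ℒ-Büchi automaton over Mⁿ: Q = Fin states, initial state q₀,
  -- finite transition relation Δ ⊆ Q × Φₙ × Q (a list), accepting set F.
  record Automaton (n : ℕ) : Set where
    field
      states    : ℕ
      initial   : Fin states
      trans     : List (Fin states × Formula n × Fin states)
      accepting : Subset states

  Word : ℕ → Set
  Word n = ℕ → Vector M n

  record Run {n : ℕ} (B : Automaton n) (w : Word n) : Set where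
    open Automaton B
    field
      ρ       : ℕ → Fin states
      start   : ρ 0 ≡ initial
      step    : ∀ i → Σ[ φ ∈ Formula n ] (((ρ i , φ , ρ (suc i)) ∈ₗ trans) × Sat (w i) φ)
      buchi   : ∀ i → Σ[ j ∈ ℕ ] (i ≤ j × ρ j ∈ accepting)

  Accepts : ∀ {n} → Automaton n → Word n → Set
  Accepts B w = Run B w

  -- Effective closure: the automaton is computed by an (Agda, hence
  -- computable) function of the given automata.
  EffClosedUnion : Set
  EffClosedUnion =
    Σ[ f ∈ (∀ {n} → Automaton n → Automaton n → Automaton n) ]
      (∀ {n} (A B : Automaton n) (w : Word n) →
         Accepts (f A B) w ⇔ (Accepts A w ⊎ Accepts B w))

  EffClosedProjection : Set
  EffClosedProjection =
    Σ[ f ∈ (∀ {n} → Automaton (suc n) → Automaton n) ]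
      (∀ {n} (B : Automaton (suc n)) (w : Word n) →
         Accepts (f B) w ⇔
         (Σ[ w′ ∈ Word (suc n) ] ((∀ i k → init (w′ i) k ≡ w i k) × Accepts B w′)))

  -- complementation w.r.t. (Mⁿ)^ω; correctness is asserted in a classical
  -- metatheory (excluded middle), the construction itself is not allowed
  -- to use it.
  EffClosedComplement : Set₁
  EffClosedComplement =
    Σ[ f ∈ (∀ {n} → Automaton n → Automaton n) ]
      (ExcludedMiddle 0ℓ →
       ∀ {n} (B : Automaton n) (w : Word n) →
         Accepts (f B) w ⇔ (¬ Accepts B w))

module Submission where

-- Union and projection are the classical constructions, carried out on formula-labelled transitions:
-- a fresh initial state for the union, and quantifying away the last variable of every label for the
-- projection. For the complement of an automaton B with k states, a letter v ∈ Mⁿ matters only through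
-- the k × k Boolean matrix of transitions of B that it enables, and the letters inducing a given matrix
-- are defined by an ℒ-formula. This reduces the problem to Büchi's complementation over the finite
-- alphabet of such matrices: by Ramsey's theorem every word factors as u v₁ v₂ ⋯ where all vᵢ have the
-- same transition profile e, idempotent and absorbed by the profile s of u, and B rejects the word iff
-- no accepting lasso fits (s , e). The complement automaton guesses this factorisation.

open import Axiom.ExcludedMiddle using (ExcludedMiddle)
open import Data.Bool using (Bool; true; false; if_then_else_)
open import Data.Empty using (⊥; ⊥-elim)
open import Data.Fin using (Fin; zero; suc) renaming (_≟_ to _≟ᶠ_)
open import Data.Fin.Properties using (all?)
open import Data.Fin.Subset using () renaming (_∈_ to _∈ₛ_)
open import Data.List as List
  using (List; []; _∷_; map; _++_; filter; concatMap; allFin; cartesianProduct; cartesianProductWith)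
open import Data.List.Membership.Propositional using (_∈_; find; lose)
open import Data.List.Membership.Propositional.Properties
open import Data.List.Relation.Unary.All as All using (All; []; _∷_)
import Data.List.Relation.Unary.All.Properties as All
open import Data.List.Relation.Unary.Any using (Any; here; there; index)
open import Data.List.Relation.Unary.Any.Properties using (lookup-index)
open import Data.Maybe as Maybe using (Maybe; just; nothing)
open import Data.Nat
  using (ℕ; zero; suc; _≤_; _<_; _≤?_; _<?_; z≤n; s≤s; s≤s⁻¹; _⊔_; _≤′_; ≤′-refl; ≤′-step)
  renaming (_≟_ to _≟ⁿ_)
open import Data.Nat.Properties
open import Data.Product using (Σ-syntax; ∃-syntax; _×_; _,_; proj₁; proj₂)
open import Data.Sum using (_⊎_; inj₁; inj₂; swap; [_,_])
open import Data.Sum.Function.Propositional using (_⊎-⇔_)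
open import Data.Unit using (⊤; tt)
open import Data.Vec using (Vec; []; _∷_; lookup; tabulate)
open import Data.Vec.Functional using (Vector; init)
open import Data.Vec.Properties
  using (lookup∘tabulate; tabulate∘lookup; tabulate-cong; ≡-dec; []=⇒lookup; lookup⇒[]=)
open import Function using (_∘_; id)
open import Function.Bundles using (_⇔_; mk⇔; Equivalence)
open import Function.Construct.Composition using (_⇔-∘_)
open import Function.Construct.Symmetry using (⇔-sym)
open import Function.Properties.Equivalence using (⇔-setoid)
open import Function.Related.TypeIsomorphisms using (¬-cong-⇔)
open import Level using (0ℓ)
open import Relation.Binary.Definitions using (DecidableEquality; tri<; tri≈; tri>)
open import Relation.Binary.PropositionalEquality
  using (_≡_; refl; sym; trans; cong; cong₂; subst; subst₂; module ≡-Reasoning)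
open import Relation.Nullary using (¬_; Dec; yes; no; does)
open import Relation.Nullary.Decidable using (_×-dec_; _→-dec_; ¬?; dec-true; dec-false)

open import Defs

record Enumerable (A : Set) : Set where
  field
    elements : List A
    complete : ∀ x → x ∈ elements

Enumerable-Fin : ∀ n → Enumerable (Fin n)
Enumerable-Fin n = record { elements = allFin n ; complete = ∈-allFin }

Enumerable-Bool : Enumerable Bool
Enumerable-Bool = record
  { elements = true ∷ false ∷ [] ; complete = λ { true → here refl ; false → there (here refl) } }

module _ {A B : Set} (EA : Enumerable A) (EB : Enumerable B) where
  open Enumerable

  Enumerable-⊎ : Enumerable (A ⊎ B)
  Enumerable-⊎ = record
    { elements = map inj₁ (elements EA) ++ map inj₂ (elements EB)
    ; complete = λ { (inj₁ x) → ∈-++⁺ˡ (∈-map⁺ inj₁ (complete EA x))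
                   ; (inj₂ y) → ∈-++⁺ʳ _ (∈-map⁺ inj₂ (complete EB y)) } }

  Enumerable-× : Enumerable (A × B)
  Enumerable-× = record
    { elements = cartesianProduct (elements EA) (elements EB)
    ; complete = λ (x , y) → ∈-cartesianProduct⁺ (complete EA x) (complete EB y) }

module _ {A : Set} (EA : Enumerable A) where
  open Enumerable EA

  Enumerable-Maybe : Enumerable (Maybe A)
  Enumerable-Maybe = record
    { elements = nothing ∷ map just elements
    ; complete = λ { nothing → here refl ; (just x) → there (∈-map⁺ just (complete x)) } }

  Enumerable-Vec : ∀ n → Enumerable (Vec A n)
  Enumerable-Vec zero = record { elements = [] ∷ [] ; complete = λ { [] → here refl } }
  Enumerable-Vec (suc n) = record
    { elements = cartesianProductWith _∷_ elements (Enumerable.elements (Enumerable-Vec n))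
    ; complete = λ { (x ∷ v) →
        ∈-cartesianProductWith⁺ _∷_ (complete x) (Enumerable.complete (Enumerable-Vec n) v) } }

  module FinEncoding where

    size : ℕ
    size = List.length elements

    encode : A → Fin size
    encode x = index (complete x)

    decode : Fin size → A
    decode = List.lookup elements

    decode-encode : ∀ x → decode (encode x) ≡ x
    decode-encode x = sym (lookup-index (complete x))

-- Infinite sets of natural numbers and Ramsey's theorem

Infinite : (ℕ → Set) → Set
Infinite P = ∀ n → ∃[ m ] (n ≤ m × P m)

Infinite-mono : {P Q : ℕ → Set} → (∀ {m} → P m → Q m) → Infinite P → Infinite Q
Infinite-mono P⇒Q inf n = let (m , n≤m , pm) = inf n in m , n≤m , P⇒Q pm

Infinite-beyond : {P : ℕ → Set} (n₀ : ℕ) → Infinite P → Infinite (λ m → P m × n₀ ≤ m)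
Infinite-beyond n₀ inf n =
  let (m , n⊔n₀≤m , pm) = inf (n ⊔ n₀)
  in m , ≤-trans (m≤m⊔n n n₀) n⊔n₀≤m , pm , ≤-trans (m≤n⊔m n n₀) n⊔n₀≤m

Increasing : (ℕ → ℕ) → Set
Increasing f = ∀ i → f i < f (suc i)

module _ {f : ℕ → ℕ} (f-inc : Increasing f) where

  Increasing⇒< : ∀ {i j} → i < j → f i < f j
  Increasing⇒< {i} (s≤s i≤j) with m≤n⇒m<n∨m≡n i≤j
  ... | inj₂ refl = f-inc i
  Increasing⇒< {i} {suc j} (s≤s i≤j) | inj₁ i<j = <-trans (Increasing⇒< i<j) (f-inc j)

  Increasing⇒≤ : ∀ {i j} → i ≤ j → f i ≤ f j
  Increasing⇒≤ i≤j with m≤n⇒m<n∨m≡n i≤j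
  ... | inj₁ i<j = <⇒≤ (Increasing⇒< i<j)
  ... | inj₂ refl = ≤-refl

  Increasing⇒≥id : ∀ i → i ≤ f i
  Increasing⇒≥id zero = z≤n
  Increasing⇒≥id (suc i) = ≤-trans (s≤s (Increasing⇒≥id i)) (f-inc i)

enumerate : {P : ℕ → Set} → Infinite P → Σ[ h ∈ (ℕ → ℕ) ] (Increasing h × ∀ i → P (h i))
enumerate {P} inf = h , h-inc , h-P
  where
  h : ℕ → ℕ
  h zero = proj₁ (inf 0)
  h (suc i) = proj₁ (inf (suc (h i)))
  h-inc : Increasing h
  h-inc i = proj₁ (proj₂ (inf (suc (h i))))
  h-P : ∀ i → P (h i)
  h-P zero = proj₂ (proj₂ (inf 0))
  h-P (suc i) = proj₂ (proj₂ (inf (suc (h i))))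

module Classical (em : ExcludedMiddle 0ℓ) where

  ¬Infinite⇒eventually¬ : {P : ℕ → Set} → ¬ Infinite P → ∃[ n₀ ] (∀ m → n₀ ≤ m → ¬ P m)
  ¬Infinite⇒eventually¬ {P} ¬inf with em {∃[ n₀ ] (∀ m → n₀ ≤ m → ¬ P m)}
  ... | yes eventually = eventually
  ... | no ¬eventually = ⊥-elim (¬inf inf)
    where
    inf : Infinite P
    inf n with em {∃[ m ] (n ≤ m × P m)}
    ... | yes witness = witness
    ... | no ¬witness = ⊥-elim (¬eventually (n , λ m n≤m pm → ¬witness (m , n≤m , pm)))

  pigeonhole : {X : Set} (xs : List X) (c : ℕ → X) {P : ℕ → Set} → Infinite P →
               (∀ {m} → P m → c m ∈ xs) → ∃[ x ] Infinite (λ m → P m × c m ≡ x)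
  pigeonhole [] c inf c∈xs with inf 0
  ... | _ , _ , pm with () ← c∈xs pm
  pigeonhole (x ∷ xs) c {P} inf c∈xs with em {Infinite (λ m → P m × c m ≡ x)}
  ... | yes x-inf = x , x-inf
  ... | no ¬x-inf =
    let (n₀ , not-x) = ¬Infinite⇒eventually¬ ¬x-inf
        (y , y-inf) = pigeonhole xs c (Infinite-beyond n₀ inf) (c∈xs′ not-x)
    in y , Infinite-mono (λ ((pm , _) , cm≡y) → pm , cm≡y) y-inf
    where
    c∈xs′ : ∀ {n₀} → (∀ m → n₀ ≤ m → ¬ (P m × c m ≡ x)) → ∀ {m} → P m × n₀ ≤ m → c m ∈ xs
    c∈xs′ not-x {m} (pm , n₀≤m) with c∈xs pm
    ... | here cm≡x = ⊥-elim (not-x m n₀≤m (pm , cm≡x))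
    ... | there cm∈xs = cm∈xs

  -- Stage i + 1 keeps the members of stage i beyond its pivot whose colour with the pivot is one that
  -- occurs infinitely often, so c (pivot i) (pivot j) depends only on i < j; a second pigeonhole
  -- on that colour selects the subsequence.
  ramsey : {X : Set} → Enumerable X → (c : ℕ → ℕ → X) →
           ∃[ x ] ∃[ h ] (Increasing h × ∀ {i j} → i < j → c (h i) (h j) ≡ x)
  ramsey {X} (record { elements = xs ; complete = complete }) c = y , pivot ∘ g , h-inc , h-colour
    where
    record Stage : Set₁ where
      field
        Member : ℕ → Set
        infinite : Infinite Member
    open Stage

    pick : Stage → ℕ
    pick S = proj₁ (infinite S 0)

    split : (S : Stage) → ∃[ x ] Infinite (λ m → (Member S m × suc (pick S) ≤ m) × c (pick S) m ≡ x)
    split S = pigeonhole xs (c (pick S)) (Infinite-beyond (suc (pick S)) (infinite S)) (λ _ → complete _)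

    stage : ℕ → Stage
    stage zero = record { Member = λ _ → ⊤ ; infinite = λ n → n , ≤-refl , tt }
    stage (suc i) = record { infinite = proj₂ (split (stage i)) }

    pivot : ℕ → ℕ
    pivot i = pick (stage i)

    colour : ℕ → X
    colour i = proj₁ (split (stage i))

    Member-antitone : ∀ {i j m} → i ≤′ j → Member (stage j) m → Member (stage i) m
    Member-antitone ≤′-refl member = member
    Member-antitone (≤′-step i≤′j) ((member , _) , _) = Member-antitone i≤′j member

    pivot-colour : ∀ {i j} → i < j → pivot i < pivot j × c (pivot i) (pivot j) ≡ colour i
    pivot-colour {i} {j} i<j =
      let ((_ , later) , col) = Member-antitone (≤⇒≤′ i<j) (proj₂ (proj₂ (infinite (stage j) 0)))
      in later , col

    y-infinite : ∃[ y ] Infinite (λ i → ⊤ × colour i ≡ y)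
    y-infinite = pigeonhole xs colour (λ n → n , ≤-refl , tt) (λ _ → complete _)

    y : X
    y = proj₁ y-infinite

    g-enum : Σ[ g ∈ (ℕ → ℕ) ] (Increasing g × ∀ i → ⊤ × colour (g i) ≡ y)
    g-enum = enumerate (proj₂ y-infinite)

    g : ℕ → ℕ
    g = proj₁ g-enum

    h-inc : Increasing (pivot ∘ g)
    h-inc i = proj₁ (pivot-colour (proj₁ (proj₂ g-enum) i))

    h-colour : ∀ {i j} → i < j → c (pivot (g i)) (pivot (g j)) ≡ y
    h-colour {i} i<j = trans (proj₂ (pivot-colour (Increasing⇒< (proj₁ (proj₂ g-enum)) i<j)))
                             (proj₂ (proj₂ (proj₂ g-enum) i))

module Gluing (G : ℕ → ℕ) (G-zero : G 0 ≡ 0) (G-inc : Increasing G) where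

  InSegment : ℕ → ℕ → Set
  InSegment i m = G i ≤ m × m < G (suc i)

  locate : ∀ m → Σ[ i ∈ ℕ ] InSegment i m
  locate zero = 0 , ≤-reflexive G-zero , subst (_< G 1) G-zero (G-inc 0)
  locate (suc m) with locate m
  ... | i , Gi≤m , m<G with suc m <? G (suc i)
  ... | yes sm<G = i , ≤-trans Gi≤m (n≤1+n m) , sm<G
  ... | no sm≮G = suc i , ≮⇒≥ sm≮G , <-≤-trans (s≤s m<G) (G-inc (suc i))

  InSegment-unique : ∀ {i j m} → InSegment i m → InSegment j m → i ≡ j
  InSegment-unique {i} {j} (Gi≤m , m<Gi) (Gj≤m , m<Gj) with <-cmp i j
  ... | tri< i<j _ _ = ⊥-elim (<-irrefl refl (<-≤-trans m<Gi (≤-trans (Increasing⇒≤ G-inc i<j) Gj≤m)))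
  ... | tri≈ _ i≡j _ = i≡j
  ... | tri> _ _ j<i = ⊥-elim (<-irrefl refl (<-≤-trans m<Gj (≤-trans (Increasing⇒≤ G-inc j<i) Gi≤m)))

  module _ {X : Set} (π : ℕ → ℕ → X) where

    glue : ℕ → X
    glue m = π (proj₁ (locate m)) m

    glue-≡ : ∀ {i m} → InSegment i m → glue m ≡ π i m
    glue-≡ {i} {m} inᵢ with InSegment-unique (proj₂ (locate m)) inᵢ
    ... | refl = refl

    glue-step : (R : ℕ → X → X → Set) →
                (∀ {i m} → G i ≤ m → suc m < G (suc i) → R m (π i m) (π i (suc m))) →
                (∀ {i m} → G i ≤ m → suc m ≡ G (suc i) → R m (π i m) (π (suc i) (suc m))) →
                ∀ m → R m (glue m) (glue (suc m))
    glue-step R inner boundary m = let (i , inᵢ) = locate m in step-from i inᵢ (suc m <? G (suc i))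
      where
      step-from : ∀ i → InSegment i m → Dec (suc m < G (suc i)) → R m (glue m) (glue (suc m))
      step-from i (Gi≤m , m<G) (yes sm<G) =
        subst₂ (R m) (sym (glue-≡ (Gi≤m , m<G))) (sym (glue-≡ (≤-trans Gi≤m (n≤1+n m) , sm<G)))
          (inner Gi≤m sm<G)
      step-from i (Gi≤m , m<G) (no sm≮G) =
        let sm≡G = ≤-antisym m<G (≮⇒≥ sm≮G) in
        subst₂ (R m) (sym (glue-≡ (Gi≤m , m<G)))
          (sym (glue-≡ (≤-reflexive (sym sm≡G) , subst (_< G (suc (suc i))) (sym sm≡G) (G-inc (suc i)))))
          (boundary Gi≤m sm≡G)

-- Büchi automata over arbitrary alphabets

record NBA (X : Set) : Set₁ where
  field
    State : Set
    initial : State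
    Step : State → X → State → Set
    Final : State → Set

record AcceptingRun {X : Set} (A : NBA X) (w : ℕ → X) : Set where
  open NBA A
  field
    ρ : ℕ → State
    ρ-initial : ρ 0 ≡ initial
    ρ-step : ∀ i → Step (ρ i) (w i) (ρ (suc i))
    ρ-final : Infinite (Final ∘ ρ)

module _ {X Y : Set} {A : NBA X} {B : NBA Y} {u : ℕ → X} {v : ℕ → Y} where
  private
    module A = NBA A
    module B = NBA B

  simulate : (f : A.State → B.State) → f A.initial ≡ B.initial →
             (∀ i {p q} → A.Step p (u i) q → B.Step (f p) (v i) (f q)) → (∀ {p} → A.Final p → B.Final (f p)) →
             AcceptingRun A u → AcceptingRun B v
  simulate f f-initial f-step f-final r = record
    { ρ = f ∘ ρ
    ; ρ-initial = trans (cong f ρ-initial) f-initial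
    ; ρ-step = λ i → f-step i (ρ-step i)
    ; ρ-final = Infinite-mono f-final ρ-final }
    where open AcceptingRun r

_∪_ : {X : Set} → NBA X → NBA X → NBA X
_∪_ {X} A B = record { State = Maybe (A.State ⊎ B.State) ; initial = nothing ; Step = Step ; Final = Final }
  where
  module A = NBA A
  module B = NBA B
  Step : Maybe (A.State ⊎ B.State) → X → Maybe (A.State ⊎ B.State) → Set
  Step nothing x (just (inj₁ q)) = A.Step A.initial x q
  Step nothing x (just (inj₂ q)) = B.Step B.initial x q
  Step (just (inj₁ p)) x (just (inj₁ q)) = A.Step p x q
  Step (just (inj₂ p)) x (just (inj₂ q)) = B.Step p x q
  Step _ _ _ = ⊥
  Final : Maybe (A.State ⊎ B.State) → Set
  Final (just (inj₁ p)) = A.Final p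
  Final (just (inj₂ p)) = B.Final p
  Final nothing = ⊥

module _ {X : Set} {A B : NBA X} {w : ℕ → X} where
  private
    module A = NBA A
    module B = NBA B
    module U = NBA (A ∪ B)

  ∪-swap : AcceptingRun (A ∪ B) w → AcceptingRun (B ∪ A) w
  ∪-swap = simulate (Maybe.map swap) refl step (λ {p} → final {p})
    where
    step : ∀ i {p q} → U.Step p (w i) q → NBA.Step (B ∪ A) (Maybe.map swap p) (w i) (Maybe.map swap q)
    step i {nothing} {just (inj₁ _)} s = s
    step i {nothing} {just (inj₂ _)} s = s
    step i {just (inj₁ _)} {just (inj₁ _)} s = s
    step i {just (inj₂ _)} {just (inj₂ _)} s = s
    final : ∀ {p} → U.Final p → NBA.Final (B ∪ A) (Maybe.map swap p)
    final {just (inj₁ _)} f = f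
    final {just (inj₂ _)} f = f

  ∪-introˡ : AcceptingRun A w → AcceptingRun (A ∪ B) w
  ∪-introˡ r = record { ρ = σ ; ρ-initial = refl ; ρ-step = step ; ρ-final = final }
    where
    open AcceptingRun r
    σ : ℕ → U.State
    σ zero = nothing
    σ (suc i) = just (inj₁ (ρ (suc i)))
    step : ∀ i → U.Step (σ i) (w i) (σ (suc i))
    step zero = subst (λ p → A.Step p (w 0) (ρ 1)) ρ-initial (ρ-step 0)
    step (suc i) = ρ-step (suc i)
    final : Infinite (U.Final ∘ σ)
    final i with ρ-final (suc i)
    ... | suc j , si≤sj , fj = suc j , ≤-trans (n≤1+n i) si≤sj , fj

  ∪-elimˡ : (r : AcceptingRun (A ∪ B) w) → ∃[ q ] (AcceptingRun.ρ r 1 ≡ just (inj₁ q)) → AcceptingRun A w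
  ∪-elimˡ r (q₁ , σ₁) = record { ρ = ρ ; ρ-initial = refl ; ρ-step = step ; ρ-final = final }
    where
    open AcceptingRun r renaming (ρ to σ; ρ-initial to σ-initial; ρ-step to σ-step; ρ-final to σ-final)
    inA : ∀ i → ∃[ q ] (σ (suc i) ≡ just (inj₁ q))
    inA zero = q₁ , σ₁
    inA (suc i) with σ (suc i) | σ (suc (suc i)) | inA i | σ-step (suc i)
    ... | _ | just (inj₁ q) | _ , refl | _ = q , refl
    ρ : ℕ → A.State
    ρ zero = A.initial
    ρ (suc i) = proj₁ (inA i)
    step : ∀ i → A.Step (ρ i) (w i) (ρ (suc i))
    step zero = subst₂ (λ p q → U.Step p (w 0) q) σ-initial σ₁ (σ-step 0)
    step (suc i) =
      subst₂ (λ p q → U.Step p (w (suc i)) q) (proj₂ (inA i)) (proj₂ (inA (suc i))) (σ-step (suc i))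
    final : Infinite (A.Final ∘ ρ)
    final i with σ-final (suc i)
    ... | suc j , si≤sj , fj = suc j , ≤-trans (n≤1+n i) si≤sj , subst U.Final (proj₂ (inA j)) fj

module _ {X : Set} {A B : NBA X} {w : ℕ → X} where

  ∪-correct : AcceptingRun (A ∪ B) w ⇔ (AcceptingRun A w ⊎ AcceptingRun B w)
  ∪-correct = mk⇔ elim [ ∪-introˡ , ∪-swap ∘ ∪-introˡ ]
    where
    elim : AcceptingRun (A ∪ B) w → AcceptingRun A w ⊎ AcceptingRun B w
    elim r with ρ r 0 | ρ-initial r | ρ r 1 in σ₁ | ρ-step r 0
      where open AcceptingRun
    ... | _ | refl | just (inj₁ q) | _ = inj₁ (∪-elimˡ r (q , σ₁))
    ... | _ | refl | just (inj₂ q) | _ = inj₂ (∪-elimˡ (∪-swap r) (q , cong (Maybe.map swap) σ₁))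

-- Transition profiles

-- An entry of a transition profile: no path, a path, or a path through a final state.
data Link : Set where
  none path accPath : Link

HasPath : Link → Set
HasPath none = ⊥
HasPath _ = ⊤

HasAccPath : Link → Set
HasAccPath accPath = ⊤
HasAccPath _ = ⊥

HasAccPath⇒HasPath : ∀ {a} → HasAccPath a → HasPath a
HasAccPath⇒HasPath {accPath} _ = tt

Link-ext : ∀ {a b} → (HasPath a → HasPath b) → (HasPath b → HasPath a) →
           (HasAccPath a → HasAccPath b) → (HasAccPath b → HasAccPath a) → a ≡ b
Link-ext {none} {none} _ _ _ _ = refl
Link-ext {none} {path} _ b⇒a _ _ = ⊥-elim (b⇒a tt)
Link-ext {none} {accPath} _ b⇒a _ _ = ⊥-elim (b⇒a tt)
Link-ext {path} {none} a⇒b _ _ _ = ⊥-elim (a⇒b tt)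
Link-ext {path} {path} _ _ _ _ = refl
Link-ext {path} {accPath} _ _ _ b⇒a = ⊥-elim (b⇒a tt)
Link-ext {accPath} {none} a⇒b _ _ _ = ⊥-elim (a⇒b tt)
Link-ext {accPath} {path} _ _ a⇒b _ = ⊥-elim (a⇒b tt)
Link-ext {accPath} {accPath} _ _ _ _ = refl

infixl 6 _⊕_
infixl 7 _⊗_

_⊕_ : Link → Link → Link
none ⊕ b = b
accPath ⊕ b = accPath
path ⊕ none = path
path ⊕ path = path
path ⊕ accPath = accPath

_⊗_ : Link → Link → Link
none ⊗ _ = none
_ ⊗ none = none
accPath ⊗ _ = accPath
_ ⊗ accPath = accPath
path ⊗ path = path

HasPath-⊕⁻ : ∀ a b → HasPath (a ⊕ b) → HasPath a ⊎ HasPath b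
HasPath-⊕⁻ none b h = inj₂ h
HasPath-⊕⁻ path b _ = inj₁ tt
HasPath-⊕⁻ accPath b _ = inj₁ tt

HasPath-⊕⁺ : ∀ a b → HasPath a ⊎ HasPath b → HasPath (a ⊕ b)
HasPath-⊕⁺ none b (inj₂ h) = h
HasPath-⊕⁺ path none _ = tt
HasPath-⊕⁺ path path _ = tt
HasPath-⊕⁺ path accPath _ = tt
HasPath-⊕⁺ accPath b _ = tt

HasAccPath-⊕⁻ : ∀ a b → HasAccPath (a ⊕ b) → HasAccPath a ⊎ HasAccPath b
HasAccPath-⊕⁻ none b h = inj₂ h
HasAccPath-⊕⁻ path accPath h = inj₂ h
HasAccPath-⊕⁻ accPath b _ = inj₁ tt

HasAccPath-⊕⁺ : ∀ a b → HasAccPath a ⊎ HasAccPath b → HasAccPath (a ⊕ b)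
HasAccPath-⊕⁺ none b (inj₂ h) = h
HasAccPath-⊕⁺ path none (inj₁ ())
HasAccPath-⊕⁺ path path (inj₁ ())
HasAccPath-⊕⁺ path accPath _ = tt
HasAccPath-⊕⁺ accPath b _ = tt

HasPath-⊗⁻ : ∀ a b → HasPath (a ⊗ b) → HasPath a × HasPath b
HasPath-⊗⁻ path path _ = tt , tt
HasPath-⊗⁻ path accPath _ = tt , tt
HasPath-⊗⁻ accPath path _ = tt , tt
HasPath-⊗⁻ accPath accPath _ = tt , tt

HasPath-⊗⁺ : ∀ {a b} → HasPath a → HasPath b → HasPath (a ⊗ b)
HasPath-⊗⁺ {path} {path} _ _ = tt
HasPath-⊗⁺ {path} {accPath} _ _ = tt
HasPath-⊗⁺ {accPath} {path} _ _ = tt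
HasPath-⊗⁺ {accPath} {accPath} _ _ = tt

HasAccPath-⊗⁻ : ∀ a b → HasAccPath (a ⊗ b) → HasPath a × HasPath b × (HasAccPath a ⊎ HasAccPath b)
HasAccPath-⊗⁻ path accPath _ = tt , tt , inj₂ tt
HasAccPath-⊗⁻ accPath path _ = tt , tt , inj₁ tt
HasAccPath-⊗⁻ accPath accPath _ = tt , tt , inj₁ tt

HasAccPath-⊗⁺ : ∀ {a b} → HasPath a → HasPath b → HasAccPath a ⊎ HasAccPath b → HasAccPath (a ⊗ b)
HasAccPath-⊗⁺ {path} {path} _ _ (inj₁ ())
HasAccPath-⊗⁺ {path} {path} _ _ (inj₂ ())
HasAccPath-⊗⁺ {path} {accPath} _ _ _ = tt
HasAccPath-⊗⁺ {accPath} {path} _ _ _ = tt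
HasAccPath-⊗⁺ {accPath} {accPath} _ _ _ = tt

⨁ : ∀ {n} → (Fin n → Link) → Link
⨁ {zero} f = none
⨁ {suc n} f = f zero ⊕ ⨁ (f ∘ suc)

module ⨁-Prime (P : Link → Set) (¬P-none : ¬ P none)
               (P-⊕⁻ : ∀ a b → P (a ⊕ b) → P a ⊎ P b) (P-⊕⁺ : ∀ a b → P a ⊎ P b → P (a ⊕ b)) where

  ⨁⁻ : ∀ {n} (f : Fin n → Link) → P (⨁ f) → ∃[ i ] P (f i)
  ⨁⁻ {zero} f h = ⊥-elim (¬P-none h)
  ⨁⁻ {suc n} f h with P-⊕⁻ (f zero) _ h
  ... | inj₁ h₀ = zero , h₀
  ... | inj₂ hₛ = let (i , hᵢ) = ⨁⁻ (f ∘ suc) hₛ in suc i , hᵢ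

  ⨁⁺ : ∀ {n} (f : Fin n → Link) i → P (f i) → P (⨁ f)
  ⨁⁺ f zero h = P-⊕⁺ (f zero) _ (inj₁ h)
  ⨁⁺ f (suc i) h = P-⊕⁺ (f zero) _ (inj₂ (⨁⁺ (f ∘ suc) i h))

open ⨁-Prime HasPath (λ ()) HasPath-⊕⁻ HasPath-⊕⁺ renaming (⨁⁻ to HasPath-⨁⁻; ⨁⁺ to HasPath-⨁⁺)
open ⨁-Prime HasAccPath (λ ()) HasAccPath-⊕⁻ HasAccPath-⊕⁺ renaming (⨁⁻ to HasAccPath-⨁⁻; ⨁⁺ to HasAccPath-⨁⁺)

HasPath? : ∀ a → Dec (HasPath a)
HasPath? none = no λ ()
HasPath? path = yes tt
HasPath? accPath = yes tt

HasAccPath? : ∀ a → Dec (HasAccPath a)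
HasAccPath? accPath = yes tt
HasAccPath? none = no λ ()
HasAccPath? path = no λ ()

_≟ᴸ_ : DecidableEquality Link
none ≟ᴸ none = yes refl
path ≟ᴸ path = yes refl
accPath ≟ᴸ accPath = yes refl
none ≟ᴸ path = no λ ()
none ≟ᴸ accPath = no λ ()
path ≟ᴸ none = no λ ()
path ≟ᴸ accPath = no λ ()
accPath ≟ᴸ none = no λ ()
accPath ≟ᴸ path = no λ ()

Enumerable-Link : Enumerable Link
Enumerable-Link = record
  { elements = none ∷ path ∷ accPath ∷ []
  ; complete = λ { none → here refl ; path → there (here refl) ; accPath → there (there (here refl)) } }

Matrix : Set → ℕ → Set
Matrix A k = Vec (Vec A k) k

module _ {A : Set} {k : ℕ} where

  infix 10 _⟨_,_⟩
  _⟨_,_⟩ : Matrix A k → Fin k → Fin k → A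
  M ⟨ p , q ⟩ = lookup (lookup M p) q

  matrix : (Fin k → Fin k → A) → Matrix A k
  matrix f = tabulate (tabulate ∘ f)

  matrix-⟨⟩ : ∀ f p q → matrix f ⟨ p , q ⟩ ≡ f p q
  matrix-⟨⟩ f p q rewrite lookup∘tabulate (tabulate ∘ f) p = lookup∘tabulate (f p) q

  Matrix-ext : {M N : Matrix A k} → (∀ p q → M ⟨ p , q ⟩ ≡ N ⟨ p , q ⟩) → M ≡ N
  Matrix-ext {M} {N} M≗N = trans (sym (tabulate∘lookup M))
    (trans (tabulate-cong λ p → trans (sym (tabulate∘lookup (lookup M p)))
                                  (trans (tabulate-cong (M≗N p)) (tabulate∘lookup (lookup N p))))
           (tabulate∘lookup N))

  Matrix-≟ : DecidableEquality A → DecidableEquality (Matrix A k)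
  Matrix-≟ _≟_ = ≡-dec (≡-dec _≟_)

Profile : ℕ → Set
Profile = Matrix Link

module _ {k : ℕ} where

  infixl 7 _⊙_
  _⊙_ : Profile k → Profile k → Profile k
  X ⊙ Y = matrix λ p r → ⨁ λ q → X ⟨ p , q ⟩ ⊗ Y ⟨ q , r ⟩

  identity : Profile k
  identity = matrix λ p q → if does (p ≟ᶠ q) then path else none

  ⊙-⟨⟩ : ∀ X Y p r → (X ⊙ Y) ⟨ p , r ⟩ ≡ ⨁ λ q → X ⟨ p , q ⟩ ⊗ Y ⟨ q , r ⟩
  ⊙-⟨⟩ X Y = matrix-⟨⟩ λ p r → ⨁ λ q → X ⟨ p , q ⟩ ⊗ Y ⟨ q , r ⟩

  module _ (X Y : Profile k) {p r : Fin k} where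

    HasPath-⊙⁻ : HasPath ((X ⊙ Y) ⟨ p , r ⟩) → ∃[ q ] (HasPath (X ⟨ p , q ⟩) × HasPath (Y ⟨ q , r ⟩))
    HasPath-⊙⁻ h rewrite ⊙-⟨⟩ X Y p r = let (q , hq) = HasPath-⨁⁻ _ h in q , HasPath-⊗⁻ _ _ hq

    HasPath-⊙⁺ : ∀ q → HasPath (X ⟨ p , q ⟩) → HasPath (Y ⟨ q , r ⟩) → HasPath ((X ⊙ Y) ⟨ p , r ⟩)
    HasPath-⊙⁺ q x y rewrite ⊙-⟨⟩ X Y p r = HasPath-⨁⁺ _ q (HasPath-⊗⁺ x y)

    HasAccPath-⊙⁻ : HasAccPath ((X ⊙ Y) ⟨ p , r ⟩) →
                    ∃[ q ] (HasPath (X ⟨ p , q ⟩) × HasPath (Y ⟨ q , r ⟩) ×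
                            (HasAccPath (X ⟨ p , q ⟩) ⊎ HasAccPath (Y ⟨ q , r ⟩)))
    HasAccPath-⊙⁻ h rewrite ⊙-⟨⟩ X Y p r = let (q , hq) = HasAccPath-⨁⁻ _ h in q , HasAccPath-⊗⁻ _ _ hq

    HasAccPath-⊙⁺ : ∀ q → HasPath (X ⟨ p , q ⟩) → HasPath (Y ⟨ q , r ⟩) →
                    HasAccPath (X ⟨ p , q ⟩) ⊎ HasAccPath (Y ⟨ q , r ⟩) → HasAccPath ((X ⊙ Y) ⟨ p , r ⟩)
    HasAccPath-⊙⁺ q x y acc rewrite ⊙-⟨⟩ X Y p r = HasAccPath-⨁⁺ _ q (HasAccPath-⊗⁺ x y acc)

  identity-⟨⟩ : ∀ p q → identity ⟨ p , q ⟩ ≡ (if does (p ≟ᶠ q) then path else none)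
  identity-⟨⟩ = matrix-⟨⟩ λ p q → if does (p ≟ᶠ q) then path else none

  module _ {p q : Fin k} where

    HasPath-identity⁻ : HasPath (identity ⟨ p , q ⟩) → p ≡ q
    HasPath-identity⁻ h rewrite identity-⟨⟩ p q with p ≟ᶠ q
    ... | yes p≡q = p≡q

    ¬HasAccPath-identity : ¬ HasAccPath (identity ⟨ p , q ⟩)
    ¬HasAccPath-identity h rewrite identity-⟨⟩ p q with p ≟ᶠ q
    ... | yes _ = h
    ... | no _ = h

  HasPath-identity⁺ : ∀ p → HasPath (identity ⟨ p , p ⟩)
  HasPath-identity⁺ p rewrite identity-⟨⟩ p p with p ≟ᶠ p
  ... | yes _ = tt
  ... | no p≢p = p≢p refl

  ⊙-assoc : ∀ X Y Z → (X ⊙ Y) ⊙ Z ≡ X ⊙ (Y ⊙ Z)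
  ⊙-assoc X Y Z = Matrix-ext λ p r → Link-ext path⇒ path⇐ acc⇒ acc⇐
    where
    path⇒ : ∀ {p r} → HasPath (((X ⊙ Y) ⊙ Z) ⟨ p , r ⟩) → HasPath ((X ⊙ (Y ⊙ Z)) ⟨ p , r ⟩)
    path⇒ h = let (q′ , xy , z) = HasPath-⊙⁻ (X ⊙ Y) Z h
                  (q , x , y) = HasPath-⊙⁻ X Y xy
              in HasPath-⊙⁺ X (Y ⊙ Z) q x (HasPath-⊙⁺ Y Z q′ y z)
    path⇐ : ∀ {p r} → HasPath ((X ⊙ (Y ⊙ Z)) ⟨ p , r ⟩) → HasPath (((X ⊙ Y) ⊙ Z) ⟨ p , r ⟩)
    path⇐ h = let (q , x , yz) = HasPath-⊙⁻ X (Y ⊙ Z) h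
                  (q′ , y , z) = HasPath-⊙⁻ Y Z yz
              in HasPath-⊙⁺ (X ⊙ Y) Z q′ (HasPath-⊙⁺ X Y q x y) z
    acc⇒ : ∀ {p r} → HasAccPath (((X ⊙ Y) ⊙ Z) ⟨ p , r ⟩) → HasAccPath ((X ⊙ (Y ⊙ Z)) ⟨ p , r ⟩)
    acc⇒ h with HasAccPath-⊙⁻ (X ⊙ Y) Z h
    ... | q′ , xy , z , inj₂ az =
      let (q , x , y) = HasPath-⊙⁻ X Y xy
      in HasAccPath-⊙⁺ X (Y ⊙ Z) q x (HasPath-⊙⁺ Y Z q′ y z) (inj₂ (HasAccPath-⊙⁺ Y Z q′ y z (inj₂ az)))
    ... | q′ , xy , z , inj₁ axy with HasAccPath-⊙⁻ X Y axy
    ... | q , x , y , inj₁ ax = HasAccPath-⊙⁺ X (Y ⊙ Z) q x (HasPath-⊙⁺ Y Z q′ y z) (inj₁ ax)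
    ... | q , x , y , inj₂ ay =
      HasAccPath-⊙⁺ X (Y ⊙ Z) q x (HasPath-⊙⁺ Y Z q′ y z) (inj₂ (HasAccPath-⊙⁺ Y Z q′ y z (inj₁ ay)))
    acc⇐ : ∀ {p r} → HasAccPath ((X ⊙ (Y ⊙ Z)) ⟨ p , r ⟩) → HasAccPath (((X ⊙ Y) ⊙ Z) ⟨ p , r ⟩)
    acc⇐ h with HasAccPath-⊙⁻ X (Y ⊙ Z) h
    ... | q , x , yz , inj₁ ax =
      let (q′ , y , z) = HasPath-⊙⁻ Y Z yz
      in HasAccPath-⊙⁺ (X ⊙ Y) Z q′ (HasPath-⊙⁺ X Y q x y) z (inj₁ (HasAccPath-⊙⁺ X Y q x y (inj₁ ax)))
    ... | q , x , yz , inj₂ ayz with HasAccPath-⊙⁻ Y Z ayz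
    ... | q′ , y , z , inj₂ az = HasAccPath-⊙⁺ (X ⊙ Y) Z q′ (HasPath-⊙⁺ X Y q x y) z (inj₂ az)
    ... | q′ , y , z , inj₁ ay =
      HasAccPath-⊙⁺ (X ⊙ Y) Z q′ (HasPath-⊙⁺ X Y q x y) z (inj₁ (HasAccPath-⊙⁺ X Y q x y (inj₂ ay)))

  ⊙-identityʳ : ∀ X → X ⊙ identity ≡ X
  ⊙-identityʳ X = Matrix-ext λ p r → Link-ext path⇒ path⇐ acc⇒ acc⇐
    where
    path⇒ : ∀ {p r} → HasPath ((X ⊙ identity) ⟨ p , r ⟩) → HasPath (X ⟨ p , r ⟩)
    path⇒ h with HasPath-⊙⁻ X identity h
    ... | q , x , i with refl ← HasPath-identity⁻ i = x
    path⇐ : ∀ {p r} → HasPath (X ⟨ p , r ⟩) → HasPath ((X ⊙ identity) ⟨ p , r ⟩)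
    path⇐ {r = r} h = HasPath-⊙⁺ X identity r h (HasPath-identity⁺ r)
    acc⇒ : ∀ {p r} → HasAccPath ((X ⊙ identity) ⟨ p , r ⟩) → HasAccPath (X ⟨ p , r ⟩)
    acc⇒ h with HasAccPath-⊙⁻ X identity h
    ... | q , x , i , inj₂ ai = ⊥-elim (¬HasAccPath-identity ai)
    ... | q , x , i , inj₁ ax with refl ← HasPath-identity⁻ i = ax
    acc⇐ : ∀ {p r} → HasAccPath (X ⟨ p , r ⟩) → HasAccPath ((X ⊙ identity) ⟨ p , r ⟩)
    acc⇐ {r = r} h = HasAccPath-⊙⁺ X identity r (HasAccPath⇒HasPath h) (HasPath-identity⁺ r) (inj₁ h)

-- Profiles of words over the alphabet of transition matrices

Letter : ℕ → Set
Letter = Matrix Bool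

module Profiles {k : ℕ} (final : Fin k → Bool) where

  link : Bool → Bool → Link
  link false _ = none
  link true false = path
  link true true = accPath

  -- A step p → q counts as visiting a final state when its source p is final.
  ⟦_⟧ : Letter k → Profile k
  ⟦ T ⟧ = matrix λ p q → link (T ⟨ p , q ⟩) (final p)

  ⟦⟧-⟨⟩ : ∀ T p q → ⟦ T ⟧ ⟨ p , q ⟩ ≡ link (T ⟨ p , q ⟩) (final p)
  ⟦⟧-⟨⟩ T = matrix-⟨⟩ λ p q → link (T ⟨ p , q ⟩) (final p)

  module _ (T : Letter k) {p q : Fin k} where

    HasPath-⟦⟧⁺ : T ⟨ p , q ⟩ ≡ true → HasPath (⟦ T ⟧ ⟨ p , q ⟩)
    HasPath-⟦⟧⁺ Tpq rewrite ⟦⟧-⟨⟩ T p q | Tpq with final p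
    ... | true = tt
    ... | false = tt

    HasPath-⟦⟧⁻ : HasPath (⟦ T ⟧ ⟨ p , q ⟩) → T ⟨ p , q ⟩ ≡ true
    HasPath-⟦⟧⁻ h rewrite ⟦⟧-⟨⟩ T p q with T ⟨ p , q ⟩
    ... | true = refl

    HasAccPath-⟦⟧⁺ : T ⟨ p , q ⟩ ≡ true → final p ≡ true → HasAccPath (⟦ T ⟧ ⟨ p , q ⟩)
    HasAccPath-⟦⟧⁺ Tpq fp rewrite ⟦⟧-⟨⟩ T p q | Tpq | fp = tt

    HasAccPath-⟦⟧⁻ : HasAccPath (⟦ T ⟧ ⟨ p , q ⟩) → final p ≡ true
    HasAccPath-⟦⟧⁻ h rewrite ⟦⟧-⟨⟩ T p q
      with T ⟨ p , q ⟩ | final p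
    ... | true | true = refl

  -- profile t i j describes the factor t i ⋯ t (j - 1), and is the identity when j ≤ i.
  profile : (ℕ → Letter k) → ℕ → ℕ → Profile k
  profile t i zero = identity
  profile t i (suc j) with i ≤? j
  ... | yes _ = profile t i j ⊙ ⟦ t j ⟧
  ... | no _ = identity

  module _ (t : ℕ → Letter k) where

    profile-refl : ∀ i → profile t i i ≡ identity
    profile-refl zero = refl
    profile-refl (suc i) with suc i ≤? i
    ... | yes i<i = ⊥-elim (<-irrefl refl i<i)
    ... | no _ = refl

    profile-suc : ∀ {i j} → i ≤ j → profile t i (suc j) ≡ profile t i j ⊙ ⟦ t j ⟧
    profile-suc {i} {j} i≤j with i ≤? j
    ... | yes _ = refl
    ... | no i≰j = ⊥-elim (i≰j i≤j)

    profile-split : ∀ {i j l} → i ≤ j → j ≤ l → profile t i l ≡ profile t i j ⊙ profile t j l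
    profile-split {i} {j} i≤j j≤l = go (≤⇒≤′ j≤l)
      where
      open ≡-Reasoning
      go : ∀ {l} → j ≤′ l → profile t i l ≡ profile t i j ⊙ profile t j l
      go ≤′-refl = begin
        profile t i j                      ≡⟨ sym (⊙-identityʳ (profile t i j)) ⟩
        profile t i j ⊙ identity           ≡⟨ cong (profile t i j ⊙_) (sym (profile-refl j)) ⟩
        profile t i j ⊙ profile t j j      ∎
      go {suc l} (≤′-step j≤′l) = begin
        profile t i (suc l)                          ≡⟨ profile-suc (≤-trans i≤j (≤′⇒≤ j≤′l)) ⟩
        profile t i l ⊙ ⟦ t l ⟧                      ≡⟨ cong (_⊙ ⟦ t l ⟧) (go j≤′l) ⟩
        profile t i j ⊙ profile t j l ⊙ ⟦ t l ⟧      ≡⟨ ⊙-assoc (profile t i j) (profile t j l) ⟦ t l ⟧ ⟩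
        profile t i j ⊙ (profile t j l ⊙ ⟦ t l ⟧)
                                                     ≡⟨ cong (profile t i j ⊙_) (sym (profile-suc (≤′⇒≤ j≤′l))) ⟩
        profile t i j ⊙ profile t j (suc l)          ∎

    Walk : (ℕ → Fin k) → ℕ → ℕ → Set
    Walk ρ i j = ∀ {m} → i ≤ m → m < j → t m ⟨ ρ m , ρ (suc m) ⟩ ≡ true

    VisitsFinal : (ℕ → Fin k) → ℕ → ℕ → Set
    VisitsFinal ρ i j = ∃[ m ] (i ≤ m × m < j × final (ρ m) ≡ true)

    Connects : (ℕ → Fin k) → ℕ → ℕ → Fin k → Fin k → Set
    Connects ρ i j p q = ρ i ≡ p × ρ j ≡ q × Walk ρ i j

    module _ {ρ : ℕ → Fin k} {i : ℕ} where

      Walk⇒HasPath : ∀ {j} → i ≤ j → Walk ρ i j → HasPath (profile t i j ⟨ ρ i , ρ j ⟩)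
      Walk⇒HasPath i≤j = go (≤⇒≤′ i≤j)
        where
        go : ∀ {j} → i ≤′ j → Walk ρ i j → HasPath (profile t i j ⟨ ρ i , ρ j ⟩)
        go ≤′-refl walk rewrite profile-refl i = HasPath-identity⁺ (ρ i)
        go {suc j} (≤′-step i≤′j) walk rewrite profile-suc (≤′⇒≤ i≤′j) =
          HasPath-⊙⁺ (profile t i j) ⟦ t j ⟧ (ρ j) (go i≤′j λ i≤m m<j → walk i≤m (m<n⇒m<1+n m<j))
                               (HasPath-⟦⟧⁺ (t j) (walk (≤′⇒≤ i≤′j) ≤-refl))

      Walk⇒HasAccPath : ∀ {j} → i ≤ j → Walk ρ i j → VisitsFinal ρ i j →
                        HasAccPath (profile t i j ⟨ ρ i , ρ j ⟩)
      Walk⇒HasAccPath i≤j = go (≤⇒≤′ i≤j)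
        where
        go : ∀ {j} → i ≤′ j → Walk ρ i j → VisitsFinal ρ i j → HasAccPath (profile t i j ⟨ ρ i , ρ j ⟩)
        go ≤′-refl walk (m , i≤m , m<i , _) = ⊥-elim (<-irrefl refl (≤-<-trans i≤m m<i))
        go {suc j} (≤′-step i≤′j) walk (m , i≤m , m<sj , fm) rewrite profile-suc (≤′⇒≤ i≤′j) =
          HasAccPath-⊙⁺ (profile t i j) ⟦ t j ⟧ (ρ j) (Walk⇒HasPath (≤′⇒≤ i≤′j) walk′) (HasPath-⟦⟧⁺ (t j) step)
            last-or-earlier
          where
          walk′ : Walk ρ i j
          walk′ i≤m m<j = walk i≤m (m<n⇒m<1+n m<j)
          step : t j ⟨ ρ j , ρ (suc j) ⟩ ≡ true
          step = walk (≤′⇒≤ i≤′j) ≤-refl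
          last-or-earlier : HasAccPath (profile t i j ⟨ ρ i , ρ j ⟩) ⊎ HasAccPath (⟦ t j ⟧ ⟨ ρ j , ρ (suc j) ⟩)
          last-or-earlier with m≤n⇒m<n∨m≡n (s≤s⁻¹ m<sj)
          ... | inj₁ m<j = inj₁ (go i≤′j walk′ (m , i≤m , m<j , fm))
          ... | inj₂ refl = inj₂ (HasAccPath-⟦⟧⁺ (t m) step fm)

    extend : (ℕ → Fin k) → ℕ → Fin k → ℕ → Fin k
    extend ρ j r m with m ≤? j
    ... | yes _ = ρ m
    ... | no _ = r

    extend-≤ : ∀ {ρ j r m} → m ≤ j → extend ρ j r m ≡ ρ m
    extend-≤ {j = j} {m = m} m≤j with m ≤? j
    ... | yes _ = refl
    ... | no m≰j = ⊥-elim (m≰j m≤j)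

    extend-suc : ∀ {ρ j r} → extend ρ j r (suc j) ≡ r
    extend-suc {j = j} with suc j ≤? j
    ... | yes j<j = ⊥-elim (<-irrefl refl j<j)
    ... | no _ = refl

    Connects-extend : ∀ {ρ i j p q r} → i ≤ j → Connects ρ i j p q → t j ⟨ q , r ⟩ ≡ true →
                      Connects (extend ρ j r) i (suc j) p r
    Connects-extend {ρ} {i} {j} {r = r} i≤j (ρi , ρj , walk) step =
      trans (extend-≤ {ρ} {j} {r} i≤j) ρi , extend-suc {ρ} {j} {r} , walk′
      where
      walk′ : Walk (extend ρ j r) i (suc j)
      walk′ {m} i≤m m<sj with m≤n⇒m<n∨m≡n (s≤s⁻¹ m<sj)
      ... | inj₁ m<j rewrite extend-≤ {ρ} {r = r} (<⇒≤ m<j) | extend-≤ {ρ} {r = r} m<j = walk i≤m m<j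
      ... | inj₂ refl rewrite extend-≤ {ρ} {r = r} (≤-refl {m}) | extend-suc {ρ} {m} {r} | ρj = step

    module _ {i : ℕ} {p : Fin k} where

      HasPath⇒Connects : ∀ {j q} → i ≤ j → HasPath (profile t i j ⟨ p , q ⟩) →
                         Σ[ ρ ∈ (ℕ → Fin k) ] Connects ρ i j p q
      HasPath⇒Connects i≤j = go (≤⇒≤′ i≤j)
        where
        go : ∀ {j q} → i ≤′ j → HasPath (profile t i j ⟨ p , q ⟩) → Σ[ ρ ∈ (ℕ → Fin k) ] Connects ρ i j p q
        go {q = q} ≤′-refl h rewrite profile-refl i with refl ← HasPath-identity⁻ {p = p} {q = q} h =
          (λ _ → p) , refl , refl , λ i≤m m<i → ⊥-elim (<-irrefl refl (≤-<-trans i≤m m<i))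
        go {suc j} {r} (≤′-step i≤′j) h rewrite profile-suc (≤′⇒≤ i≤′j) =
          let (q , hq , step) = HasPath-⊙⁻ (profile t i j) ⟦ t j ⟧ h
              (ρ , connects) = go i≤′j hq
          in extend ρ j r , Connects-extend (≤′⇒≤ i≤′j) connects (HasPath-⟦⟧⁻ (t j) step)

      HasAccPath⇒Connects : ∀ {j q} → i ≤ j → HasAccPath (profile t i j ⟨ p , q ⟩) →
                            Σ[ ρ ∈ (ℕ → Fin k) ] (Connects ρ i j p q × VisitsFinal ρ i j)
      HasAccPath⇒Connects i≤j = go (≤⇒≤′ i≤j)
        where
        go : ∀ {j q} → i ≤′ j → HasAccPath (profile t i j ⟨ p , q ⟩) →
             Σ[ ρ ∈ (ℕ → Fin k) ] (Connects ρ i j p q × VisitsFinal ρ i j)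
        go {q = q} ≤′-refl h rewrite profile-refl i = ⊥-elim (¬HasAccPath-identity {p = p} {q = q} h)
        go {suc j} {r} (≤′-step i≤′j) h rewrite profile-suc (≤′⇒≤ i≤′j)
          with HasAccPath-⊙⁻ (profile t i j) ⟦ t j ⟧ h
        ... | q , hq , step , inj₁ acc =
          let (ρ , connects , (m , i≤m , m<j , fm)) = go i≤′j acc
          in extend ρ j r , Connects-extend (≤′⇒≤ i≤′j) connects (HasPath-⟦⟧⁻ (t j) step) ,
             m , i≤m , m<n⇒m<1+n m<j , trans (cong final (extend-≤ {ρ} {j} {r} (<⇒≤ m<j))) fm
        ... | q , hq , step , inj₂ acc =
          let (ρ , connects) = HasPath⇒Connects (≤′⇒≤ i≤′j) hq
          in extend ρ j r , Connects-extend (≤′⇒≤ i≤′j) connects (HasPath-⟦⟧⁻ (t j) step) ,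
             j , ≤′⇒≤ i≤′j , ≤-refl ,
             trans (cong final (trans (extend-≤ {ρ} {j} {r} ≤-refl) (proj₁ (proj₂ connects))))
                   (HasAccPath-⟦⟧⁻ (t j) acc)

-- Complementation over the alphabet of transition matrices

module Symbolic {k : ℕ} (q₀ : Fin k) (final : Fin k → Bool) where
  open Profiles final

  automaton : NBA (Letter k)
  automaton = record
    { State = Fin k ; initial = q₀ ; Step = λ p T q → T ⟨ p , q ⟩ ≡ true ; Final = λ p → final p ≡ true }

  Rejecting : Profile k → Profile k → Set
  Rejecting s e = ∀ q → HasPath (s ⟨ q₀ , q ⟩) → ¬ HasAccPath (e ⟨ q , q ⟩)

  Admissible : Profile k → Profile k → Set
  Admissible s e = e ⊙ e ≡ e × s ⊙ e ≡ s × Rejecting s e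

  -- inj₁ s: still reading the prefix, whose profile is s;
  -- inj₂ (e , c , b): reading the loops of profile e, the current one has profile c so far,
  -- and b records that a loop has just been closed.
  State : Set
  State = Profile k ⊎ (Profile k × Profile k × Bool)

  Step : State → Letter k → State → Set
  Step (inj₁ s) T (inj₁ s′) = s′ ≡ s ⊙ ⟦ T ⟧
  Step (inj₁ s) T (inj₂ (e , c , true)) = c ≡ identity × Admissible (s ⊙ ⟦ T ⟧) e
  Step (inj₂ (e , c , _)) T (inj₂ (e′ , c′ , true)) = e′ ≡ e × c′ ≡ identity × c ⊙ ⟦ T ⟧ ≡ e
  Step (inj₂ (e , c , _)) T (inj₂ (e′ , c′ , false)) = e′ ≡ e × c′ ≡ c ⊙ ⟦ T ⟧
  Step _ _ _ = ⊥

  closed : State → Bool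
  closed (inj₁ _) = false
  closed (inj₂ (_ , _ , b)) = b

  complement : NBA (Letter k)
  complement = record
    { State = State ; initial = inj₁ identity ; Step = Step ; Final = λ x → closed x ≡ true }

  infix 4 _≟ᴾ_
  _≟ᴾ_ : (X Y : Profile k) → Dec (X ≡ Y)
  _≟ᴾ_ = Matrix-≟ _≟ᴸ_

  admissible? : ∀ s e → Dec (Admissible s e)
  admissible? s e = (e ⊙ e ≟ᴾ e) ×-dec (s ⊙ e ≟ᴾ s) ×-dec
                    all? (λ q → HasPath? (s ⟨ q₀ , q ⟩) →-dec ¬? (HasAccPath? (e ⟨ q , q ⟩)))

  step? : ∀ x T y → Dec (Step x T y)
  step? (inj₁ s) T (inj₁ s′) = s′ ≟ᴾ (s ⊙ ⟦ T ⟧)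
  step? (inj₁ s) T (inj₂ (e , c , true)) = (c ≟ᴾ identity) ×-dec admissible? (s ⊙ ⟦ T ⟧) e
  step? (inj₁ s) T (inj₂ (e , c , false)) = no λ ()
  step? (inj₂ _) T (inj₁ _) = no λ ()
  step? (inj₂ (e , c , _)) T (inj₂ (e′ , c′ , true)) = (e′ ≟ᴾ e) ×-dec (c′ ≟ᴾ identity) ×-dec (c ⊙ ⟦ T ⟧ ≟ᴾ e)
  step? (inj₂ (e , c , _)) T (inj₂ (e′ , c′ , false)) = (e′ ≟ᴾ e) ×-dec (c′ ≟ᴾ c ⊙ ⟦ T ⟧)

  Enumerable-Profile : Enumerable (Profile k)
  Enumerable-Profile = Enumerable-Vec (Enumerable-Vec Enumerable-Link k) k

  Enumerable-State : Enumerable State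
  Enumerable-State =
    Enumerable-⊎ Enumerable-Profile
                 (Enumerable-× Enumerable-Profile (Enumerable-× Enumerable-Profile Enumerable-Bool))

  module Invariants (t : ℕ → Letter k) where

    -- n is the most recent loop boundary.
    Tracks : ℕ → State → Set
    Tracks m (inj₁ c) = c ≡ profile t 0 m
    Tracks m (inj₂ (e , c , b)) =
      ∃[ n ] (n ≤ m × Admissible (profile t 0 n) e × c ≡ profile t n m × (b ≡ true → n ≡ m))

    Tracks-step : ∀ {m x y} → Tracks m x → Step x (t m) y → Tracks (suc m) y
    Tracks-step {m} {inj₁ _} {inj₁ _} refl refl = sym (profile-suc t z≤n)
    Tracks-step {m} {inj₁ _} {inj₂ (e , _ , true)} refl (refl , admissible) =
      suc m , ≤-refl , subst (λ s → Admissible s e) (sym (profile-suc t z≤n)) admissible ,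
      sym (profile-refl t (suc m)) , λ _ → refl
    Tracks-step {m} {inj₂ (e , _ , _)} {inj₂ (_ , _ , true)}
                (n , n≤m , admissible , refl , _) (refl , refl , closes) =
      suc m , ≤-refl , subst (λ s → Admissible s e) (sym prefix-unchanged) admissible ,
      sym (profile-refl t (suc m)) , λ _ → refl
      where
      open ≡-Reasoning
      prefix-unchanged : profile t 0 (suc m) ≡ profile t 0 n
      prefix-unchanged = begin
        profile t 0 (suc m)                          ≡⟨ profile-split t z≤n (m≤n⇒m≤1+n n≤m) ⟩
        profile t 0 n ⊙ profile t n (suc m)          ≡⟨ cong (profile t 0 n ⊙_) (profile-suc t n≤m) ⟩
        profile t 0 n ⊙ (profile t n m ⊙ ⟦ t m ⟧)    ≡⟨ cong (profile t 0 n ⊙_) closes ⟩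
        profile t 0 n ⊙ e                            ≡⟨ proj₁ (proj₂ admissible) ⟩
        profile t 0 n                                ∎
    Tracks-step {m} {inj₂ _} {inj₂ (_ , _ , false)} (n , n≤m , admissible , refl , _) (refl , refl) =
      n , m≤n⇒m≤1+n n≤m , admissible , sym (profile-suc t n≤m) , λ ()

    -- Relative to a fixed loop boundary r, every later boundary n satisfies profile t r n ≡ e.
    LoopTracks : ℕ → Profile k → ℕ → State → Set
    LoopTracks r e m (inj₁ _) = ⊥
    LoopTracks r e m (inj₂ (e′ , c , b)) =
      e′ ≡ e × ∃[ n ] (r ≤ n × n ≤ m × c ≡ profile t n m × (n ≡ r ⊎ profile t r n ≡ e) × (b ≡ true → n ≡ m))

    Tracks-closed : ∀ {m x} → Tracks m x → closed x ≡ true →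
                    ∃[ e ] (Admissible (profile t 0 m) e × LoopTracks m e m x)
    Tracks-closed {m} {inj₂ (e , c , true)} (n , _ , admissible , c≡ , n≡m) _ with refl ← n≡m refl =
      e , admissible , refl , m , ≤-refl , ≤-refl , c≡ , inj₁ refl , λ _ → refl

    LoopTracks-step : ∀ {r e m x y} → e ⊙ e ≡ e → LoopTracks r e m x → Step x (t m) y → LoopTracks r e (suc m) y
    LoopTracks-step {r} {e} {m} {inj₂ _} {inj₂ (_ , _ , true)}
                    idem (refl , n , r≤n , n≤m , refl , loops , _) (refl , refl , closes) =
      refl , suc m , ≤-trans r≤n (m≤n⇒m≤1+n n≤m) , ≤-refl , sym (profile-refl t (suc m)) ,
      inj₂ (r-to-sm loops) , λ _ → refl
      where
      n-to-sm : profile t n (suc m) ≡ e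
      n-to-sm = trans (profile-suc t n≤m) closes
      r-to-sm : n ≡ r ⊎ profile t r n ≡ e → profile t r (suc m) ≡ e
      r-to-sm (inj₁ n≡r) = subst (λ n → profile t n (suc m) ≡ e) n≡r n-to-sm
      r-to-sm (inj₂ r-to-n) =
        trans (profile-split t r≤n (m≤n⇒m≤1+n n≤m)) (trans (cong₂ _⊙_ r-to-n n-to-sm) idem)
    LoopTracks-step {x = inj₂ _} {inj₂ (_ , _ , false)}
                    idem (refl , n , r≤n , n≤m , refl , loops , _) (refl , refl) =
      refl , n , r≤n , m≤n⇒m≤1+n n≤m , sym (profile-suc t n≤m) , loops , λ ()

    LoopTracks-closed : ∀ {r e m x} → r < m → LoopTracks r e m x → closed x ≡ true → profile t r m ≡ e
    LoopTracks-closed {x = inj₂ (_ , _ , true)} r<m (_ , _ , _ , _ , _ , inj₁ refl , n≡m) _ =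
      ⊥-elim (<-irrefl (n≡m refl) r<m)
    LoopTracks-closed {x = inj₂ (_ , _ , true)} r<m (_ , _ , _ , _ , _ , inj₂ r-to-n , n≡m) _
      with refl ← n≡m refl = r-to-n

  module _ {t : ℕ → Letter k} (G : ℕ → ℕ) (G-zero : G 0 ≡ 0) (G-inc : Increasing G) where
    open Gluing G G-zero G-inc

    lasso : ∀ {q} → HasPath (profile t (G 0) (G 1) ⟨ q₀ , q ⟩) →
            (∀ i → HasAccPath (profile t (G (suc i)) (G (suc (suc i))) ⟨ q , q ⟩)) → AcceptingRun automaton t
    lasso {q} prefix loop = record
      { ρ = glue π
      ; ρ-initial = subst (λ m → glue π m ≡ q₀) G-zero
                      (trans (glue-≡ π (≤-refl , G-inc 0)) (proj₁ (proj₂ (segment 0))))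
      ; ρ-step = glue-step π (λ m p q → t m ⟨ p , q ⟩ ≡ true) inner boundary
      ; ρ-final = final′ }
      where
      start : ℕ → Fin k
      start zero = q₀
      start (suc _) = q
      segment : ∀ i → Σ[ ρ ∈ (ℕ → Fin k) ] Connects t ρ (G i) (G (suc i)) (start i) q
      segment zero = HasPath⇒Connects t (<⇒≤ (G-inc 0)) prefix
      segment (suc i) =
        let (ρ , connects , _) = HasAccPath⇒Connects t (<⇒≤ (G-inc (suc i))) (loop i) in ρ , connects
      π : ℕ → ℕ → Fin k
      π i = proj₁ (segment i)
      walk : ∀ i → Walk t (π i) (G i) (G (suc i))
      walk i = proj₂ (proj₂ (proj₂ (segment i)))
      agree : ∀ i → π i (G (suc i)) ≡ π (suc i) (G (suc i))
      agree i = trans (proj₁ (proj₂ (proj₂ (segment i)))) (sym (proj₁ (proj₂ (segment (suc i)))))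
      inner : ∀ {i m} → G i ≤ m → suc m < G (suc i) → t m ⟨ π i m , π i (suc m) ⟩ ≡ true
      inner {i} Gi≤m sm<G = walk i Gi≤m (<-trans (n<1+n _) sm<G)
      boundary : ∀ {i m} → G i ≤ m → suc m ≡ G (suc i) → t m ⟨ π i m , π (suc i) (suc m) ⟩ ≡ true
      boundary {i} {m} Gi≤m sm≡G =
        subst (λ p → t m ⟨ π i m , p ⟩ ≡ true) (subst (λ n → π i n ≡ π (suc i) n) (sym sm≡G) (agree i))
          (walk i Gi≤m (≤-reflexive sm≡G))
      final′ : Infinite (λ m → final (glue π m) ≡ true)
      final′ n =
        let (m , Gsn≤m , m<G , fm) = proj₂ (proj₂ (HasAccPath⇒Connects t (<⇒≤ (G-inc (suc n))) (loop n)))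
        in m , ≤-trans (≤-trans (n≤1+n n) (Increasing⇒≥id G-inc (suc n))) Gsn≤m ,
           trans (cong final (glue-≡ π (Gsn≤m , m<G))) fm

    module _ {e : Profile k} (admissible : Admissible (profile t (G 0) (G 1)) e)
             (loop : ∀ i → profile t (G (suc i)) (G (suc (suc i))) ≡ e) where

      phase : ℕ → ℕ → State
      phase zero m = inj₁ (profile t 0 m)
      phase (suc i) m = inj₂ (e , profile t (G (suc i)) m , does (m ≟ⁿ G (suc i)))

      phase-start : ∀ i → phase (suc i) (G (suc i)) ≡ inj₂ (e , identity , true)
      phase-start i rewrite profile-refl t (G (suc i)) | dec-true (G (suc i) ≟ⁿ G (suc i)) refl = refl

      inner : ∀ {i m} → G i ≤ m → suc m < G (suc i) → Step (phase i m) (t m) (phase i (suc m))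
      inner {zero} _ _ = profile-suc t z≤n
      inner {suc i} {m} Gi≤m _
        rewrite dec-false (suc m ≟ⁿ G (suc i)) (λ sm≡G → <-irrefl (sym sm≡G) (s≤s Gi≤m)) =
        refl , profile-suc t Gi≤m

      closes : ∀ {i m} → G i ≤ m → suc m ≡ G (suc i) → Step (phase i m) (t m) (inj₂ (e , identity , true))
      closes {zero} {m} _ sm≡G =
        refl ,
        subst (λ s → Admissible s e) (trans (cong (profile t 0) (sym sm≡G)) (profile-suc t z≤n)) admissible′
        where
        admissible′ : Admissible (profile t 0 (G 1)) e
        admissible′ = subst (λ n → Admissible (profile t n (G 1)) e) G-zero admissible
      closes {suc i} {m} Gi≤m sm≡G =
        refl , refl , trans (sym (profile-suc t Gi≤m)) (trans (cong (profile t (G (suc i))) sm≡G) (loop i))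

      boundary : ∀ {i m} → G i ≤ m → suc m ≡ G (suc i) → Step (phase i m) (t m) (phase (suc i) (suc m))
      boundary {i} Gi≤m sm≡G =
        subst (Step _ _) (sym (trans (cong (phase (suc i)) sm≡G) (phase-start i))) (closes Gi≤m sm≡G)

      complement-run : AcceptingRun complement t
      complement-run = record
        { ρ = glue phase
        ; ρ-initial = subst (λ m → glue phase m ≡ inj₁ (profile t 0 m)) G-zero (glue-≡ phase (≤-refl , G-inc 0))
        ; ρ-step = glue-step phase (λ m x y → Step x (t m) y) inner boundary
        ; ρ-final = λ n → G (suc n) , ≤-trans (n≤1+n n) (Increasing⇒≥id G-inc (suc n)) ,
                          cong closed (trans (glue-≡ phase (≤-refl , G-inc (suc n))) (phase-start n)) }

  module _ (em : ExcludedMiddle 0ℓ) {t : ℕ → Letter k} where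
    open Classical em
    open Invariants t

    module _ (C : AcceptingRun complement t) (B : AcceptingRun automaton t) where
      open AcceptingRun C renaming (ρ to σ; ρ-initial to σ-initial; ρ-step to σ-step; ρ-final to σ-final)
      open AcceptingRun B

      tracks : ∀ m → Tracks m (σ m)
      tracks zero = subst (Tracks 0) (sym σ-initial) refl
      tracks (suc m) = Tracks-step (tracks m) (σ-step m)

      loop-tracks : ∀ {r e} → e ⊙ e ≡ e → LoopTracks r e r (σ r) → ∀ {m} → r ≤′ m → LoopTracks r e m (σ m)
      loop-tracks idem start ≤′-refl = start
      loop-tracks idem start {suc m} (≤′-step r≤′m) =
        LoopTracks-step idem (loop-tracks idem start r≤′m) (σ-step m)

      walk : ∀ {i j} → Walk t ρ i j
      walk _ _ = ρ-step _

      -- Some state q of B is visited at infinitely many loop boundaries; between two of them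
      -- B visits a final state, which makes (q₀ → q, q → q) witness that (s , e) is not rejecting.
      runs-incompatible : ⊥
      runs-incompatible with pigeonhole (allFin k) ρ σ-final (λ {m} _ → ∈-allFin (ρ m))
      ... | q , recurrent with recurrent 0
      ... | m₁ , _ , closed₁ , ρm₁ with Tracks-closed (tracks m₁) closed₁
      ... | e , (idem , _ , rejecting) , loop₁ with ρ-final m₁
      ... | a , m₁≤a , final-a with recurrent (suc a)
      ... | m₂ , a<m₂ , closed₂ , ρm₂ = rejecting q prefix-path loop-acc
        where
        m₁<m₂ : m₁ < m₂
        m₁<m₂ = ≤-<-trans m₁≤a a<m₂
        loop : profile t m₁ m₂ ≡ e
        loop = LoopTracks-closed m₁<m₂ (loop-tracks idem loop₁ (≤⇒≤′ (<⇒≤ m₁<m₂))) closed₂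
        prefix-path : HasPath (profile t 0 m₁ ⟨ q₀ , q ⟩)
        prefix-path = subst₂ (λ p p′ → HasPath (profile t 0 m₁ ⟨ p , p′ ⟩)) ρ-initial ρm₁
                        (Walk⇒HasPath t {j = m₁} z≤n walk)
        loop-acc : HasAccPath (e ⟨ q , q ⟩)
        loop-acc = subst (λ X → HasAccPath (X ⟨ q , q ⟩)) loop
          (subst₂ (λ p p′ → HasAccPath (profile t m₁ m₂ ⟨ p , p′ ⟩)) ρm₁ ρm₂
            (Walk⇒HasAccPath t (<⇒≤ m₁<m₂) walk (a , m₁≤a , a<m₂ , final-a)))

    complement-sound : AcceptingRun complement t → ¬ AcceptingRun automaton t
    complement-sound = runs-incompatible

    -- Ramsey's theorem cuts t into a prefix of profile s followed by loops of one profile e.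
    complement-complete : ¬ AcceptingRun automaton t → AcceptingRun complement t
    complement-complete ¬B with ramsey Enumerable-Profile (profile t)
    ... | e , h , h-inc , h-colour = complement-run G refl G-inc (idem , absorbs , rejecting) loop
      where
      open ≡-Reasoning
      G : ℕ → ℕ
      G zero = 0
      G (suc i) = h (suc i)
      G-inc : Increasing G
      G-inc zero = ≤-<-trans z≤n (h-inc 0)
      G-inc (suc i) = h-inc (suc i)
      loop : ∀ i → profile t (G (suc i)) (G (suc (suc i))) ≡ e
      loop i = h-colour (n<1+n (suc i))
      h≤ : ∀ i → h i ≤ h (suc i)
      h≤ i = <⇒≤ (h-inc i)
      h₀₁ : profile t (h 0) (h 1) ≡ e
      h₀₁ = h-colour (n<1+n 0)
      h₁₂ : profile t (h 1) (h 2) ≡ e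
      h₁₂ = h-colour (n<1+n 1)
      h₀₂ : profile t (h 0) (h 2) ≡ e
      h₀₂ = h-colour (s≤s z≤n)
      idem : e ⊙ e ≡ e
      idem = begin
        e ⊙ e                                          ≡⟨ cong₂ _⊙_ (sym h₀₁) (sym h₁₂) ⟩
        profile t (h 0) (h 1) ⊙ profile t (h 1) (h 2)  ≡⟨ sym (profile-split t (h≤ 0) (h≤ 1)) ⟩
        profile t (h 0) (h 2)                          ≡⟨ h₀₂ ⟩
        e                                              ∎
      absorbs : profile t 0 (h 1) ⊙ e ≡ profile t 0 (h 1)
      absorbs = begin
        profile t 0 (h 1) ⊙ e                          ≡⟨ cong (profile t 0 (h 1) ⊙_) (sym h₁₂) ⟩
        profile t 0 (h 1) ⊙ profile t (h 1) (h 2)      ≡⟨ sym (profile-split t z≤n (h≤ 1)) ⟩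
        profile t 0 (h 2)                              ≡⟨ profile-split t z≤n (≤-trans (h≤ 0) (h≤ 1)) ⟩
        profile t 0 (h 0) ⊙ profile t (h 0) (h 2)      ≡⟨ cong (profile t 0 (h 0) ⊙_) (trans h₀₂ (sym h₀₁)) ⟩
        profile t 0 (h 0) ⊙ profile t (h 0) (h 1)      ≡⟨ sym (profile-split t z≤n (h≤ 0)) ⟩
        profile t 0 (h 1)                              ∎
      rejecting : Rejecting (profile t 0 (h 1)) e
      rejecting q prefix acc =
        ¬B (lasso G refl G-inc prefix λ i → subst (λ X → HasAccPath (X ⟨ q , q ⟩)) (sym (loop i)) acc)

    complement-correct : AcceptingRun complement t ⇔ (¬ AcceptingRun automaton t)
    complement-correct = mk⇔ complement-sound complement-complete

-- 𝓜-ℒ-Büchi automata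

module _ {M : Set} (L : Logic M) where
  open Logic L renaming (true to ⊤ᶠ; _and_ to _∧ᶠ_; not to ¬ᶠ)

  ⋀ : ∀ {n} → List (Formula n) → Formula n
  ⋀ [] = ⊤ᶠ
  ⋀ (φ ∷ φs) = φ ∧ᶠ ⋀ φs

  module _ {n} {v : Vector M n} where

    Sat-⋀⁺ : ∀ {φs} → All (Sat v) φs → Sat v (⋀ φs)
    Sat-⋀⁺ [] = Equivalence.from (Sat-true v) tt
    Sat-⋀⁺ (sat ∷ sats) = Equivalence.from (Sat-and v _ _) (sat , Sat-⋀⁺ sats)

    Sat-⋀⁻ : ∀ φs → Sat v (⋀ φs) → All (Sat v) φs
    Sat-⋀⁻ [] _ = []
    Sat-⋀⁻ (φ ∷ φs) sat = let (sat₁ , sats) = Equivalence.to (Sat-and v _ _) sat in sat₁ ∷ Sat-⋀⁻ φs sats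

  -- A finite automaton whose edge from x to y carries the finite disjunction of labels x y.
  record Presentation (n : ℕ) : Set₁ where
    field
      State : Set
      enumerable : Enumerable State
      initial : State
      labels : State → State → List (Formula n)
      final : State → Bool

  presented : ∀ {n} → Presentation n → NBA (Vector M n)
  presented P = record
    { State = State ; initial = initial
    ; Step = λ x v y → Any (Sat v) (labels x y) ; Final = λ x → final x ≡ true }
    where open Presentation P

  nba : ∀ {n} → Automaton L n → NBA (Vector M n)
  nba B = record
    { State = Fin states ; initial = initial
    ; Step = λ p v q → Σ[ φ ∈ Formula _ ] ((p , φ , q) ∈ Δ × Sat v φ) ; Final = _∈ₛ accepting }
    where open Automaton B renaming (trans to Δ)

  Accepts⇔AcceptingRun : ∀ {n} {B : Automaton L n} {w} → Accepts L B w ⇔ AcceptingRun (nba B) w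
  Accepts⇔AcceptingRun = mk⇔
    (λ r → let open Run r in record { ρ = ρ ; ρ-initial = start ; ρ-step = step ; ρ-final = buchi })
    (λ r → let open AcceptingRun r in record { ρ = ρ ; start = ρ-initial ; step = ρ-step ; buchi = ρ-final })

  module _ {n} (P : Presentation n) where
    open Presentation P
    open Enumerable enumerable
    open FinEncoding enumerable

    edges : Fin size × Fin size → List (Fin size × Formula n × Fin size)
    edges (i , j) = map (λ φ → i , φ , j) (labels (decode i) (decode j))

    compile : Automaton L n
    compile = record
      { states = size
      ; initial = encode initial
      ; trans = concatMap edges (cartesianProduct (allFin size) (allFin size))
      ; accepting = tabulate (final ∘ decode) }

    ∈-edges⁺ : ∀ {i φ j} → φ ∈ labels (decode i) (decode j) → (i , φ , j) ∈ Automaton.trans compile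
    ∈-edges⁺ {i} {φ} {j} φ∈ =
      ∈-concatMap⁺ edges (lose (∈-cartesianProduct⁺ (∈-allFin i) (∈-allFin j)) (∈-map⁺ (λ φ → i , φ , j) φ∈))

    ∈-edges⁻ : ∀ {i φ j} → (i , φ , j) ∈ Automaton.trans compile → φ ∈ labels (decode i) (decode j)
    ∈-edges⁻ e∈ with find (∈-concatMap⁻ edges {xs = cartesianProduct (allFin size) (allFin size)} e∈)
    ... | (i , j) , _ , e∈edges with ∈-map⁻ (λ φ → i , φ , j) e∈edges
    ... | _ , φ∈ , refl = φ∈

    compile-correct : ∀ {w} → Accepts L compile w ⇔ AcceptingRun (presented P) w
    compile-correct {w} = runs ⇔-∘ Accepts⇔AcceptingRun
      where
      decode-step : ∀ i {j l} → NBA.Step (nba compile) j (w i) l →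
                    Any (Sat (w i)) (labels (decode j) (decode l))
      decode-step _ (_ , e∈ , sat) = lose (∈-edges⁻ e∈) sat
      encode-step : ∀ i {x y} → Any (Sat (w i)) (labels x y) →
                    NBA.Step (nba compile) (encode x) (w i) (encode y)
      encode-step _ {x = x} {y} step =
        let (φ , φ∈ , sat) = find step
        in φ , ∈-edges⁺ (subst₂ (λ x y → φ ∈ labels x y) (sym (decode-encode x)) (sym (decode-encode y)) φ∈) ,
           sat
      decode-final : ∀ {j} → j ∈ₛ tabulate (final ∘ decode) → final (decode j) ≡ true
      decode-final {j} j∈ = trans (sym (lookup∘tabulate (final ∘ decode) j)) ([]=⇒lookup j∈)
      encode-final : ∀ {x} → final x ≡ true → encode x ∈ₛ tabulate (final ∘ decode)
      encode-final {x} fx =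
        lookup⇒[]= (encode x) _
          (trans (lookup∘tabulate (final ∘ decode) (encode x)) (trans (cong final (decode-encode x)) fx))
      runs : AcceptingRun (nba compile) w ⇔ AcceptingRun (presented P) w
      runs = mk⇔ (simulate decode (decode-encode initial) decode-step decode-final)
                 (simulate encode refl encode-step encode-final)

  module _ {n} (B : Automaton L n) where
    open Automaton B renaming (trans to Δ)

    Edge : Set
    Edge = Fin states × Formula n × Fin states

    between? : ∀ p q (e : Edge) → Dec (proj₁ e ≡ p × proj₂ (proj₂ e) ≡ q)
    between? p q (p′ , _ , q′) = (p′ ≟ᶠ p) ×-dec (q′ ≟ᶠ q)

    edgeLabels : Fin states → Fin states → List (Formula n)
    edgeLabels p q = map (proj₁ ∘ proj₂) (filter (between? p q) Δ)

    ∈-edgeLabels⁺ : ∀ {p φ q} → (p , φ , q) ∈ Δ → φ ∈ edgeLabels p q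
    ∈-edgeLabels⁺ {p} {φ} {q} e∈ = ∈-map⁺ (proj₁ ∘ proj₂) (∈-filter⁺ (between? p q) e∈ (refl , refl))

    ∈-edgeLabels⁻ : ∀ {p φ q} → φ ∈ edgeLabels p q → (p , φ , q) ∈ Δ
    ∈-edgeLabels⁻ {p} {φ} {q} φ∈ with ∈-map⁻ (proj₁ ∘ proj₂) φ∈
    ... | _ , e∈ , refl with ∈-filter⁻ (between? p q) e∈
    ... | e∈Δ , refl , refl = e∈Δ

    present : Presentation n
    present = record
      { State = Fin states ; enumerable = Enumerable-Fin states ; initial = initial
      ; labels = edgeLabels ; final = lookup accepting }

    present-correct : ∀ {w} → Accepts L B w ⇔ AcceptingRun (presented present) w
    present-correct = runs ⇔-∘ Accepts⇔AcceptingRun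
      where
      runs : ∀ {w} → AcceptingRun (nba B) w ⇔ AcceptingRun (presented present) w
      runs = mk⇔
        (simulate id refl (λ _ (_ , e∈ , sat) → lose (∈-edgeLabels⁺ e∈) sat) []=⇒lookup)
        (simulate id refl (λ _ step → let (φ , φ∈ , sat) = find step in φ , ∈-edgeLabels⁻ φ∈ , sat)
                          (lookup⇒[]= _ accepting))

  union : ∀ {n} → Presentation n → Presentation n → Presentation n
  union {n} P Q = record
    { State = Maybe (P.State ⊎ Q.State)
    ; enumerable = Enumerable-Maybe (Enumerable-⊎ P.enumerable Q.enumerable)
    ; initial = nothing
    ; labels = labels
    ; final = final }
    where
    module P = Presentation P
    module Q = Presentation Q
    labels : Maybe (P.State ⊎ Q.State) → Maybe (P.State ⊎ Q.State) → List (Formula n)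
    labels nothing (just (inj₁ q)) = P.labels P.initial q
    labels nothing (just (inj₂ q)) = Q.labels Q.initial q
    labels (just (inj₁ p)) (just (inj₁ q)) = P.labels p q
    labels (just (inj₂ p)) (just (inj₂ q)) = Q.labels p q
    labels _ _ = []
    final : Maybe (P.State ⊎ Q.State) → Bool
    final nothing = false
    final (just (inj₁ p)) = P.final p
    final (just (inj₂ q)) = Q.final q

  union-correct : ∀ {n} {P Q : Presentation n} {w} →
                  AcceptingRun (presented (union P Q)) w ⇔ AcceptingRun (presented P ∪ presented Q) w
  union-correct {P = P} {Q} {w} =
    mk⇔ (simulate id refl to (λ {x} → final-to {x})) (simulate id refl from (λ {x} → final-from {x}))
    where
    module U = NBA (presented (union P Q))
    module V = NBA (presented P ∪ presented Q)
    to : ∀ i {x y} → U.Step x (w i) y → V.Step x (w i) y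
    to _ {nothing} {just (inj₁ _)} s = s
    to _ {nothing} {just (inj₂ _)} s = s
    to _ {just (inj₁ _)} {just (inj₁ _)} s = s
    to _ {just (inj₂ _)} {just (inj₂ _)} s = s
    from : ∀ i {x y} → V.Step x (w i) y → U.Step x (w i) y
    from _ {nothing} {just (inj₁ _)} s = s
    from _ {nothing} {just (inj₂ _)} s = s
    from _ {just (inj₁ _)} {just (inj₁ _)} s = s
    from _ {just (inj₂ _)} {just (inj₂ _)} s = s
    final-to : ∀ {x} → U.Final x → V.Final x
    final-to {just (inj₁ _)} f = f
    final-to {just (inj₂ _)} f = f
    final-from : ∀ {x} → V.Final x → U.Final x
    final-from {just (inj₁ _)} f = f
    final-from {just (inj₂ _)} f = f

  project : ∀ {n} → Automaton L (suc n) → Automaton L n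
  project B = record { states = states ; initial = initial ; trans = map existsEdge Δ ; accepting = accepting }
    where
    open Automaton B renaming (trans to Δ)
    existsEdge : Fin states × Formula _ × Fin states → Fin states × Formula _ × Fin states
    existsEdge (p , φ , q) = p , exists φ , q

  module _ {n} (B : Automaton L (suc n)) (w : Word L n) where
    open Automaton B renaming (trans to Δ)

    Extends : Word L (suc n) → Set
    Extends w′ = ∀ i k → init (w′ i) k ≡ w i k

    project-correct : Accepts L (project B) w ⇔ (Σ[ w′ ∈ Word L (suc n) ] (Extends w′ × Accepts L B w′))
    project-correct = mk⇔ to from
      where
      to : Accepts L (project B) w → Σ[ w′ ∈ Word L (suc n) ] (Extends w′ × Accepts L B w′)
      to r = (λ i → proj₁ (lift i)) , (λ i → proj₁ (proj₂ (lift i))) ,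
             record { ρ = ρ ; start = start ; step = λ i → proj₂ (proj₂ (lift i)) ; buchi = buchi }
        where
        open Run r
        lift : ∀ i → Σ[ u ∈ Vector M (suc n) ] ((∀ k → init u k ≡ w i k) ×
                     Σ[ φ ∈ Formula (suc n) ] ((ρ i , φ , ρ (suc i)) ∈ Δ × Sat u φ))
        lift i with step i
        ... | _ , e∈ , sat with ∈-map⁻ _ e∈
        ... | (_ , φ , _) , e∈Δ , refl =
          let (u , u-extends , sat′) = Equivalence.to (Sat-exists (w i) φ) sat in u , u-extends , φ , e∈Δ , sat′
      from : Σ[ w′ ∈ Word L (suc n) ] (Extends w′ × Accepts L B w′) → Accepts L (project B) w
      from (w′ , extends , r) = record { ρ = ρ ; start = start ; step = step′ ; buchi = buchi }
        where
        open Run r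
        step′ : ∀ i → Σ[ ψ ∈ Formula n ] ((ρ i , ψ , ρ (suc i)) ∈ Automaton.trans (project B) × Sat (w i) ψ)
        step′ i = let (φ , e∈ , sat) = step i in
          exists φ , ∈-map⁺ _ e∈ , Equivalence.from (Sat-exists (w i) φ) (w′ i , extends i , sat)

  module Complementation {n} (B : Automaton L n) where
    open Automaton B renaming (trans to Δ)
    open Symbolic initial (lookup accepting)
    open Profiles (lookup accepting)

    Enumerable-Letter : Enumerable (Letter states)
    Enumerable-Letter = Enumerable-Vec (Enumerable-Vec Enumerable-Bool states) states

    noEdge : Fin states → Fin states → Formula n
    noEdge p q = ⋀ (map ¬ᶠ (edgeLabels B p q))

    literal : Letter states → Fin states × Fin states → Formula n
    literal T (p , q) = if T ⟨ p , q ⟩ then ¬ᶠ (noEdge p q) else noEdge p q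

    -- Satisfied by v exactly when T records which transitions of B the letter v enables.
    atom : Letter states → Formula n
    atom T = ⋀ (map (literal T) (cartesianProduct (allFin states) (allFin states)))

    letters : List (Letter states)
    letters = Enumerable.elements Enumerable-Letter

    complementLabels : State → State → List (Formula n)
    complementLabels x y = map atom (filter (λ T → step? x T y) letters)

    complementPresentation : Presentation n
    complementPresentation = record
      { State = State ; enumerable = Enumerable-State ; initial = inj₁ identity
      ; labels = complementLabels ; final = closed }

    module _ {v : Vector M n} {p q : Fin states} where

      Sat-noEdge⁺ : ¬ Any (Sat v) (edgeLabels B p q) → Sat v (noEdge p q)
      Sat-noEdge⁺ ¬step =
        Sat-⋀⁺ (All.map⁺ (All.map (λ ¬sat → Equivalence.from (Sat-not v _) ¬sat) (All.¬Any⇒All¬ _ ¬step)))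

      Sat-noEdge⁻ : Sat v (noEdge p q) → ¬ Any (Sat v) (edgeLabels B p q)
      Sat-noEdge⁻ sat = All.All¬⇒¬Any (All.map (λ {φ} → Equivalence.to (Sat-not v φ)) (All.map⁻ (Sat-⋀⁻ _ sat)))

    module _ (em : ExcludedMiddle 0ℓ) where

      letterOf : Vector M n → Letter states
      letterOf v = matrix λ p q → does (em {Any (Sat v) (edgeLabels B p q)})

      module _ {v : Vector M n} {p q : Fin states} where

        letterOf-⟨⟩ : letterOf v ⟨ p , q ⟩ ≡ does (em {Any (Sat v) (edgeLabels B p q)})
        letterOf-⟨⟩ = matrix-⟨⟩ (λ p q → does (em {Any (Sat v) (edgeLabels B p q)})) p q

        letterOf⁺ : Any (Sat v) (edgeLabels B p q) → letterOf v ⟨ p , q ⟩ ≡ true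
        letterOf⁺ step = trans letterOf-⟨⟩ (dec-true em step)

        letterOf⁻ : letterOf v ⟨ p , q ⟩ ≡ true → Any (Sat v) (edgeLabels B p q)
        letterOf⁻ T⟨p,q⟩ rewrite letterOf-⟨⟩ with em {Any (Sat v) (edgeLabels B p q)}
        ... | yes step = step

        Sat-literal-letterOf : Sat v (literal (letterOf v) (p , q))
        Sat-literal-letterOf rewrite letterOf-⟨⟩ with em {Any (Sat v) (edgeLabels B p q)}
        ... | yes step = Equivalence.from (Sat-not v _) (λ sat → Sat-noEdge⁻ sat step)
        ... | no ¬step = Sat-noEdge⁺ ¬step

        Sat-literal⇒letterOf : ∀ {T} → Sat v (literal T (p , q)) → T ⟨ p , q ⟩ ≡ letterOf v ⟨ p , q ⟩
        Sat-literal⇒letterOf {T} sat rewrite letterOf-⟨⟩ with T ⟨ p , q ⟩ | em {Any (Sat v) (edgeLabels B p q)}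
        ... | true | yes _ = refl
        ... | true | no ¬step = ⊥-elim (Equivalence.to (Sat-not v _) sat (Sat-noEdge⁺ ¬step))
        ... | false | yes step = ⊥-elim (Sat-noEdge⁻ sat step)
        ... | false | no _ = refl

      Sat-atom-letterOf : ∀ v → Sat v (atom (letterOf v))
      Sat-atom-letterOf v = Sat-⋀⁺ (All.map⁺ {xs = cartesianProduct (allFin states) (allFin states)}
                                             (All.tabulate λ {(p , q)} _ → Sat-literal-letterOf))

      Sat-atom⇒letterOf : ∀ {v T} → Sat v (atom T) → T ≡ letterOf v
      Sat-atom⇒letterOf {v} {T} sat = Matrix-ext λ p q →
        Sat-literal⇒letterOf {T = T}
          (All.lookup (All.map⁻ {f = literal T} (Sat-⋀⁻ _ sat)) (∈-cartesianProduct⁺ (∈-allFin p) (∈-allFin q)))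

      automaton-correct : ∀ {w} → AcceptingRun (presented (present B)) w ⇔ AcceptingRun automaton (letterOf ∘ w)
      automaton-correct = mk⇔ (simulate id refl (λ _ → letterOf⁺) id) (simulate id refl (λ _ → letterOf⁻) id)

      complementPresentation-correct : ∀ {w} →
        AcceptingRun (presented complementPresentation) w ⇔ AcceptingRun complement (letterOf ∘ w)
      complementPresentation-correct {w} = mk⇔ (simulate id refl to id) (simulate id refl from id)
        where
        to : ∀ i {x y} → Any (Sat (w i)) (complementLabels x y) → Step x (letterOf (w i)) y
        to i {x} {y} s with find s
        ... | φ , φ∈ , sat with ∈-map⁻ atom φ∈
        ... | T , T∈ , refl =
          subst (λ T → Step x T y) (Sat-atom⇒letterOf sat)
            (proj₂ (∈-filter⁻ (λ T → step? x T y) {xs = letters} T∈))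
        from : ∀ i {x y} → Step x (letterOf (w i)) y → Any (Sat (w i)) (complementLabels x y)
        from i {x} {y} step =
          lose (∈-map⁺ atom (∈-filter⁺ (λ T → step? x T y) (Enumerable.complete Enumerable-Letter _) step))
               (Sat-atom-letterOf (w i))

  unionAutomaton : ∀ {n} → Automaton L n → Automaton L n → Automaton L n
  unionAutomaton A B = compile (union (present A) (present B))

  unionAutomaton-correct : ∀ {n} (A B : Automaton L n) w →
                           Accepts L (unionAutomaton A B) w ⇔ (Accepts L A w ⊎ Accepts L B w)
  unionAutomaton-correct A B w = begin
    Accepts L (unionAutomaton A B) w                ≈⟨ compile-correct (union (present A) (present B)) ⟩
    AcceptingRun (presented (union (present A) (present B))) w      ≈⟨ union-correct ⟩
    AcceptingRun (presented (present A) ∪ presented (present B)) w  ≈⟨ ∪-correct ⟩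
    (AcceptingRun (presented (present A)) w ⊎ AcceptingRun (presented (present B)) w)
                                                    ≈⟨ ⇔-sym (present-correct A ⊎-⇔ present-correct B) ⟩
    (Accepts L A w ⊎ Accepts L B w)                 ∎
    where open import Relation.Binary.Reasoning.Setoid (⇔-setoid 0ℓ)

  complementAutomaton : ∀ {n} → Automaton L n → Automaton L n
  complementAutomaton B = compile (Complementation.complementPresentation B)

  complementAutomaton-correct : ExcludedMiddle 0ℓ → ∀ {n} (B : Automaton L n) w →
                                Accepts L (complementAutomaton B) w ⇔ (¬ Accepts L B w)
  complementAutomaton-correct em B w = begin
    Accepts L (complementAutomaton B) w                ≈⟨ compile-correct complementPresentation ⟩
    AcceptingRun (presented complementPresentation) w  ≈⟨ complementPresentation-correct em ⟩
    AcceptingRun complement (letterOf em ∘ w)          ≈⟨ complement-correct em ⟩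
    (¬ AcceptingRun automaton (letterOf em ∘ w))
                                       ≈⟨ ¬-cong-⇔ (⇔-sym (automaton-correct em ⇔-∘ present-correct B)) ⟩
    (¬ Accepts L B w)                                  ∎
    where
    open Complementation B
    open Symbolic (Automaton.initial B) (lookup (Automaton.accepting B))
    open import Relation.Binary.Reasoning.Setoid (⇔-setoid 0ℓ)

lemma3p3 : {M : Set} (L : Logic M) → TheoryDecidable L →
           EffClosedUnion L × EffClosedProjection L × EffClosedComplement L
lemma3p3 L _ =
  (unionAutomaton L , unionAutomaton-correct L) ,
  (project L , project-correct L) ,
  (complementAutomaton L , complementAutomaton-correct L)
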